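{- Let $k\ge1$ and $a\ge1$ be integers and $G=\mathrm{MCar}^{(k)}_{a+2}$. Then $$K_G\Big(\sum_{j=0}^{a-2}(a-1-j)\,\alpha_j\Big)=\mathrm{Cat}(a,ka-1),$$ i.e. the number of out-degree gravity diagrams of $G$ equals $\mathrm{Cat}(a,ka-1)$.
   Context: $\mathrm{MCar}^{(k)}_{a+2}$ is the directed multigraph on $\{0,1,\ldots,a+1\}$ with edges $(i,i+1)$ for $1\le i\le a$, $(i,a+1)$ for $1\le i\le a-1$, and $k$ distinct parallel edges $(0,i)$ for each $1\le i\le a$. Let $\varepsilon_0,\ldots,\varepsilon_{a+1}$ be the standard basis of $\mathbb R^{a+2}$, $\alpha_j=\varepsilon_j-\varepsilon_{j+1}$, and for an edge $e=(p,q)$ let $\alpha_e=\varepsilon_p-\varepsilon_q$. The Kostant partition function $K_G(\mathbf v)$ is the number of tuples $(c_e)_{e\in E(G)}$ of nonnegative integers (one entry per edge, parallel edges distinct) with $\sum_e c_e\alpha_e=\mathbf v$. $\mathrm{Cat}(a,b)=\frac1{a+b}\binom{a+b}{a}$. -}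

module Defs where

open import Data.Nat using (ℕ; zero; suc; _+_; _*_; _∸_; _<_; _≤_; s≤s; z≤n; NonZero; >-nonZero)
open import Data.Nat.Combinatorics using (_C_)
open import Data.Nat.DivMod using (_/_)
open import Data.Nat.Properties using (≤-trans; m≤m+n)
open import Data.Integer as ℤ using (ℤ; +_)
open import Data.Fin using (Fin; toℕ)
open import Data.List using (List; []; _∷_; map; upTo; replicate; concatMap; length; _++_)
open import Data.Vec using (Vec; tabulate; lookup; zipWith; replicate) renaming (_∷_ to _∷ᵥ_; [] to []ᵥ)
open import Data.Product using (Σ; _×_; _,_)
open import Relation.Binary.PropositionalEquality using (_≡_)
open import Relation.Nullary using (does)
open import Data.Bool using (Bool; true; false; if_then_else_)
open import Function.Bundles using (_↔_)

-- Directed multigraphs on vertex set {0,…,n-1}: a list of edges (p , q).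
-- Parallel edges are distinct list entries (distinguished by position).

Edges : Set
Edges = List (ℕ × ℕ)

range1 : ℕ → List ℕ
range1 m = map suc (upTo m)

MCar : (k a : ℕ) → Edges
MCar k a =
  map (λ i → (i , suc i)) (range1 a)
  ++ map (λ i → (i , suc a)) (range1 (a ∸ 1))
  ++ concatMap (λ i → Data.List.replicate k (0 , i)) (range1 a)

ε : (n : ℕ) → ℕ → Vec ℤ n
ε n p = tabulate (λ (v : Fin n) → if does (toℕ v Data.Nat.≟ p) then + 1 else + 0)

_+ᵛ_ : ∀ {n} → Vec ℤ n → Vec ℤ n → Vec ℤ n
_+ᵛ_ = zipWith ℤ._+_

_-ᵛ_ : ∀ {n} → Vec ℤ n → Vec ℤ n → Vec ℤ n
_-ᵛ_ = zipWith ℤ._-_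

_·ᵛ_ : ∀ {n} → ℕ → Vec ℤ n → Vec ℤ n
c ·ᵛ u = Data.Vec.map (λ x → + c ℤ.* x) u

0ᵛ : ∀ n → Vec ℤ n
0ᵛ n = Data.Vec.replicate n (+ 0)

αₑ : (n : ℕ) → ℕ × ℕ → Vec ℤ n
αₑ n (p , q) = ε n p -ᵛ ε n q

α : (n : ℕ) → ℕ → Vec ℤ n
α n j = ε n j -ᵛ ε n (suc j)

flow : (n : ℕ) → (E : Edges) → Vec ℕ (length E) → Vec ℤ n
flow n [] []ᵥ = 0ᵛ n
flow n (e ∷ E) (c ∷ᵥ cs) = (c ·ᵛ αₑ n e) +ᵛ flow n E cs

KPFSolutions : (n : ℕ) → Edges → Vec ℤ n → Set
KPFSolutions n E v = Σ (Vec ℕ (length E)) (λ c → flow n E c ≡ v)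

KPFCount : (n : ℕ) → Edges → Vec ℤ n → ℕ → Set
KPFCount n E v N = Fin N ↔ KPFSolutions n E v

sumTo : ∀ {n} → ℕ → (ℕ → Vec ℤ n) → Vec ℤ n
sumTo {n} zero f = 0ᵛ n
sumTo {n} (suc m) f = sumTo m f +ᵛ f m

targetVec : (a : ℕ) → Vec ℤ (suc (suc a))
targetVec a = sumTo (a ∸ 1) (λ j → (a ∸ 1 ∸ j) ·ᵛ α (suc (suc a)) j)

Cat : (a b : ℕ) → 0 < a + b → ℕ
Cat a b p = ((a + b) C a) / (a + b)
  where instance _ = >-nonZero p

cat-pos : ∀ {a} b → 1 ≤ a → 0 < a + b
cat-pos {a} b h = ≤-trans h (m≤m+n a b)

module Submission where

-- A solution is determined by its labels on the k parallel edges (0, i), i.e. by a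
-- sequence h₁, …, h_a ∈ ℕᵏ. Conservation of flow forces the edges (i, a+1) and (a, a+1)
-- to carry 0 and, for i < a, the path edge (i, i+1) to carry |h₁| + ⋯ + |hᵢ| − i, where
-- |h| is the sum of the entries of h. So the solutions correspond to the sequences of total
-- weight a − 1 that are dominating: |h₁| + ⋯ + |hᵢ| ≥ i for all i < a. By the cycle lemma,
-- exactly one of the a rotations of any sequence of a vectors of total weight a − 1 is
-- dominating, and by stars and bars there are C(ka + a − 2, a − 1) such sequences. Hence
-- K = C(ka + a − 2, a − 1) / a = C(ka + a − 1, a) / (ka + a − 1) = Cat(a, ka − 1).

open import Data.Nat using (ℕ)

module FiniteCounting where

  open import Axiom.UniquenessOfIdentityProofs using (module Decidable⇒UIP)
  open import Data.Fin using (Fin; zero; suc)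
  open import Data.Fin.Permutation using (↔⇒≡)
  import Data.Fin.Properties as Fin
  open import Data.Nat using (zero; suc; _*_)
  open import Data.Product using (Σ; _×_; _,_; proj₁; proj₂)
  open import Data.Product.Function.NonDependent.Propositional using (_×-↔_)
  open import Function using (_∘_)
  open import Function.Bundles using (_↔_; mk↔ₛ′; Inverse)
  open import Function.Properties.Inverse using (↔-refl; ↔-sym; ↔-trans)
  import Function.Related.Propositional as Related
  open import Relation.Binary.PropositionalEquality using (_≡_; refl; cong; sym; trans)
  open import Relation.Nullary using (Irrelevant; yes; no; contradiction)
  open import Relation.Unary using (Decidable)

  Fin-cong : ∀ {m n} → m ≡ n → Fin m ↔ Fin n
  Fin-cong refl = ↔-refl

  Σ-Fin-decidable↔Fin : ∀ {n} (P : Fin n → Set) → Decidable P → (∀ {i} → Irrelevant (P i)) →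
                        Σ ℕ λ c → Fin c ↔ Σ (Fin n) P
  Σ-Fin-decidable↔Fin {zero} P P? P-irr = 0 , mk↔ₛ′ (λ ()) (λ ()) (λ ()) (λ ())
  Σ-Fin-decidable↔Fin {suc n} P P? P-irr with Σ-Fin-decidable↔Fin (P ∘ suc) (P? ∘ suc) P-irr | P? zero
  ... | c , rest | no ¬p0 = c , mk↔ₛ′ to′ from′ to∘from from∘to
    where
    open Inverse rest
    to′ : Fin c → Σ (Fin (suc n)) P
    to′ i = suc (proj₁ (to i)) , proj₂ (to i)
    from′ : Σ (Fin (suc n)) P → Fin c
    from′ (zero , p) = contradiction p ¬p0
    from′ (suc j , p) = from (j , p)
    to∘from : ∀ x → to′ (from′ x) ≡ x
    to∘from (zero , p) = contradiction p ¬p0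
    to∘from (suc j , p) = cong (λ (y : Σ (Fin n) (P ∘ suc)) → suc (proj₁ y) , proj₂ y) (strictlyInverseˡ (j , p))
    from∘to : ∀ i → from′ (to′ i) ≡ i
    from∘to i = strictlyInverseʳ i
  ... | c , rest | yes p0 = suc c , mk↔ₛ′ to′ from′ to∘from from∘to
    where
    open Inverse rest
    to′ : Fin (suc c) → Σ (Fin (suc n)) P
    to′ zero = zero , p0
    to′ (suc i) = suc (proj₁ (to i)) , proj₂ (to i)
    from′ : Σ (Fin (suc n)) P → Fin (suc c)
    from′ (zero , p) = zero
    from′ (suc j , p) = suc (from (j , p))
    to∘from : ∀ x → to′ (from′ x) ≡ x
    to∘from (zero , p) = cong (zero ,_) (P-irr p0 p)
    to∘from (suc j , p) = cong (λ (y : Σ (Fin n) (P ∘ suc)) → suc (proj₁ y) , proj₂ y) (strictlyInverseˡ (j , p))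
    from∘to : ∀ i → from′ (to′ i) ≡ i
    from∘to zero = refl
    from∘to (suc i) = cong suc (strictlyInverseʳ i)

  -- G is the fibre over 0 of proj₁ ∘ e⁻¹, a decidable subset of Fin M.
  Fin-×-cancelˡ : ∀ {G : Set} r M → (Fin (suc r) × G) ↔ Fin M → Σ ℕ λ c → (suc r * c ≡ M) × (Fin c ↔ G)
  Fin-×-cancelˡ {G} r M e = c , ↔⇒≡ product , ↔-sym G↔Fin
    where
    open Inverse e
    Fibre : Fin M → Set
    Fibre j = proj₁ (from j) ≡ zero
    fibre-irr : ∀ {j} → Irrelevant (Fibre j)
    fibre-irr = Decidable⇒UIP.≡-irrelevant Fin._≟_
    G↔Fibre : G ↔ Σ (Fin M) Fibre
    G↔Fibre = mk↔ₛ′ (λ g → to (zero , g) , cong proj₁ (strictlyInverseʳ (zero , g)))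
                    (λ (j , _) → proj₂ (from j))
                    (λ (j , p) → fibre-≡ (trans (cong (λ i → to (i , proj₂ (from j))) (sym p)) (strictlyInverseˡ j)))
                    (λ g → cong proj₂ (strictlyInverseʳ (zero , g)))
      where
      fibre-≡ : ∀ {j j′} {p : Fibre j} {p′ : Fibre j′} → j ≡ j′ → (j , p) ≡ (j′ , p′)
      fibre-≡ refl = cong (_ ,_) (fibre-irr _ _)
    counted = Σ-Fin-decidable↔Fin Fibre (λ j → proj₁ (from j) Fin.≟ zero) fibre-irr
    c = proj₁ counted
    G↔Fin : G ↔ Fin c
    G↔Fin = ↔-trans G↔Fibre (↔-sym (proj₂ counted))
    product : Fin (suc r * c) ↔ Fin M
    product = Fin (suc r * c) ↔⟨ Fin.*↔× ⟩
              (Fin (suc r) × Fin c) ↔⟨ ↔-refl ×-↔ G↔Fin ⟨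
              (Fin (suc r) × G) ↔⟨ e ⟩
              Fin M ∎
      where open Related.EquationalReasoning


module StarsAndBars where

  open import Data.Empty using (⊥)
  open import Data.Fin using (Fin)
  import Data.Fin.Properties as Fin
  open import Data.Nat using (zero; suc; _+_; _∸_; s≤s)
  open import Data.Nat.Combinatorics using (_C_; nCk+nC[k+1]≡[n+1]C[k+1]; k>n⇒nCk≡0)
  open import Data.Nat.Properties using (≡-irrelevant; suc-injective; ≤-reflexive; +-identityʳ; +-suc)
  open import Data.Product using (Σ; _,_)
  open import Data.Sum using (_⊎_; inj₁; inj₂)
  open import Data.Sum.Function.Propositional using (_⊎-↔_)
  open import Data.Unit using (⊤; tt)
  open import Data.Vec using (Vec; []; _∷_; sum; replicate)
  open import Function.Bundles using (_↔_; mk↔ₛ′)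
  open import Function.Properties.Inverse using (↔-sym; ↔-trans)
  import Function.Related.Propositional as Related
  open import Relation.Binary.PropositionalEquality using (_≡_; refl; cong; sym)
  open FiniteCounting using (Fin-cong)

  Compositions : ℕ → ℕ → Set
  Compositions q m = Σ (Vec ℕ q) λ v → sum v ≡ m

  composition-≡ : ∀ {q m} {v v′ : Vec ℕ q} {p : sum v ≡ m} {p′ : sum v′ ≡ m} → v ≡ v′ →
                  _≡_ {A = Compositions q m} (v , p) (v′ , p′)
  composition-≡ {v = v} refl = cong (v ,_) (≡-irrelevant _ _)

  compositions-zero↔⊤ : ∀ q → Compositions q 0 ↔ ⊤
  compositions-zero↔⊤ q = mk↔ₛ′ (λ _ → tt) (λ _ → replicate q 0 , sum-replicate-zero q)
                                (λ _ → refl) (λ (v , p) → composition-≡ (sum≡0⇒replicate-zero v p))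
    where
    sum-replicate-zero : ∀ q → sum (replicate q 0) ≡ 0
    sum-replicate-zero zero = refl
    sum-replicate-zero (suc q) = sum-replicate-zero q
    sum≡0⇒replicate-zero : ∀ {q} (v : Vec ℕ q) → sum v ≡ 0 → replicate q 0 ≡ v
    sum≡0⇒replicate-zero [] _ = refl
    sum≡0⇒replicate-zero (zero ∷ v) p = cong (0 ∷_) (sum≡0⇒replicate-zero v p)

  no-compositions-into-zero-parts : ∀ m → Compositions 0 (suc m) ↔ ⊥
  no-compositions-into-zero-parts m = mk↔ₛ′ (λ { ([] , ()) }) (λ ()) (λ ()) (λ { ([] , ()) })

  -- Either the first part is positive (decrease it) or it is zero (drop it).
  compositions-suc↔⊎ : ∀ q m → Compositions (suc q) (suc m) ↔ (Compositions (suc q) m ⊎ Compositions q (suc m))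
  compositions-suc↔⊎ q m = mk↔ₛ′ to from to∘from from∘to
    where
    to : Compositions (suc q) (suc m) → Compositions (suc q) m ⊎ Compositions q (suc m)
    to (zero ∷ v , p) = inj₂ (v , p)
    to (suc x ∷ v , p) = inj₁ (x ∷ v , suc-injective p)
    from : Compositions (suc q) m ⊎ Compositions q (suc m) → Compositions (suc q) (suc m)
    from (inj₁ (x ∷ v , p)) = suc x ∷ v , cong suc p
    from (inj₂ (v , p)) = 0 ∷ v , p
    to∘from : ∀ c → to (from c) ≡ c
    to∘from (inj₁ (x ∷ v , p)) = cong inj₁ (composition-≡ refl)
    to∘from (inj₂ (v , p)) = refl
    from∘to : ∀ c → from (to c) ≡ c
    from∘to (zero ∷ v , p) = refl
    from∘to (suc x ∷ v , p) = composition-≡ refl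

  compositions↔ : ∀ q m → Fin ((m + q ∸ 1) C m) ↔ Compositions q m
  compositions↔ q zero = ↔-trans Fin.1↔⊤ (↔-sym (compositions-zero↔⊤ q))
  compositions↔ zero (suc m) =
    ↔-trans (Fin-cong (k>n⇒nCk≡0 (s≤s (≤-reflexive (+-identityʳ m))))) (↔-trans Fin.0↔⊥ (↔-sym (no-compositions-into-zero-parts m)))
  compositions↔ (suc q) (suc m) =
    Fin ((m + suc q) C suc m)                              ≡⟨ cong (λ n → Fin (n C suc m)) (+-suc m q) ⟩
    Fin (suc (m + q) C suc m)                              ↔⟨ Fin-cong (nCk+nC[k+1]≡[n+1]C[k+1] (m + q) m) ⟨
    Fin ((m + q) C m + (m + q) C suc m)                    ↔⟨ Fin.+↔⊎ ⟩
    (Fin ((m + q) C m) ⊎ Fin ((m + q) C suc m))            ≡⟨ cong (λ n → Fin (n C m) ⊎ Fin ((m + q) C suc m)) (cong (_∸ 1) (sym (+-suc m q))) ⟩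
    (Fin ((m + suc q ∸ 1) C m) ⊎ Fin ((suc m + q ∸ 1) C suc m)) ↔⟨ compositions↔ (suc q) m ⊎-↔ compositions↔ q (suc m) ⟩
    (Compositions (suc q) m ⊎ Compositions q (suc m))      ↔⟨ compositions-suc↔⊎ q m ⟨
    Compositions (suc q) (suc m)                           ∎
    where open Related.EquationalReasoning


module Binomial where

  open import Data.Nat using (zero; suc; _+_; _*_; _/_)
  open import Data.Nat.Combinatorics using (_C_; nCk+nC[k+1]≡[n+1]C[k+1]; nC1≡n)
  open import Data.Nat.DivMod using (m*n/n≡m)
  open import Data.Nat.Properties using (+-comm; +-identityʳ; *-identityʳ; *-zeroʳ; *-cancelˡ-≡)
  open import Data.Nat.Tactic.RingSolver using (solve-∀)
  open import Relation.Binary.PropositionalEquality using (_≡_; refl; cong; cong₂; sym; trans; module ≡-Reasoning)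

  [k+1]*[n+1]C[k+1]≡[n+1]*nCk : ∀ n k → suc k * (suc n C suc k) ≡ suc n * (n C k)
  [k+1]*[n+1]C[k+1]≡[n+1]*nCk zero zero = refl
  [k+1]*[n+1]C[k+1]≡[n+1]*nCk zero (suc k) = *-zeroʳ (suc (suc k))
  [k+1]*[n+1]C[k+1]≡[n+1]*nCk (suc n) zero = trans (+-identityʳ _) (trans (nC1≡n (suc (suc n))) (sym (*-identityʳ (suc (suc n)))))
  [k+1]*[n+1]C[k+1]≡[n+1]*nCk (suc n) (suc k) = begin
    suc (suc k) * (suc N C suc (suc k))                     ≡⟨ cong (suc (suc k) *_) (nCk+nC[k+1]≡[n+1]C[k+1] N (suc k)) ⟨
    suc (suc k) * (N C suc k + N C suc (suc k))             ≡⟨ expand k (N C suc k) (N C suc (suc k)) ⟩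
    suc k * (N C suc k) + N C suc k + suc (suc k) * (N C suc (suc k))
      ≡⟨ cong₂ (λ x y → x + N C suc k + y) ([k+1]*[n+1]C[k+1]≡[n+1]*nCk n k) ([k+1]*[n+1]C[k+1]≡[n+1]*nCk n (suc k)) ⟩
    N * (n C k) + N C suc k + N * (n C suc k)               ≡⟨ regroup N (n C k) (n C suc k) (N C suc k) ⟩
    N * (n C k + n C suc k) + N C suc k                     ≡⟨ cong (λ x → N * x + N C suc k) (nCk+nC[k+1]≡[n+1]C[k+1] n k) ⟩
    N * (N C suc k) + N C suc k                             ≡⟨ +-comm (N * (N C suc k)) (N C suc k) ⟩
    suc N * (N C suc k)                                     ∎
    where
    open ≡-Reasoning
    N = suc n
    expand : ∀ k x y → suc (suc k) * (x + y) ≡ suc k * x + x + suc (suc k) * y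
    expand = solve-∀
    regroup : ∀ N x y z → N * x + z + N * y ≡ N * (x + y) + z
    regroup = solve-∀

  [k+1]*c≡nCk⇒[n+1]C[k+1]/[n+1]≡c : ∀ n k c → suc k * c ≡ n C k → (suc n C suc k) / suc n ≡ c
  [k+1]*c≡nCk⇒[n+1]C[k+1]/[n+1]≡c n k c [k+1]c≡nCk = trans (cong (_/ suc n) (*-cancelˡ-≡ _ _ (suc k) absorbed)) (m*n/n≡m c (suc n))
    where
    absorbed : suc k * (suc n C suc k) ≡ suc k * (c * suc n)
    absorbed = begin
      suc k * (suc n C suc k)  ≡⟨ [k+1]*[n+1]C[k+1]≡[n+1]*nCk n k ⟩
      suc n * (n C k)          ≡⟨ cong (suc n *_) [k+1]c≡nCk ⟨
      suc n * (suc k * c)      ≡⟨ solve (suc n) (suc k) c ⟩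
      suc k * (c * suc n)      ∎
      where
      open ≡-Reasoning
      solve : ∀ x y z → x * (y * z) ≡ y * (z * x)
      solve = solve-∀


module ListRotation {A : Set} where

  open import Data.List using (List; []; _∷_; _++_; length; take; drop)
  open import Data.List.Properties using (take++drop≡id; length-drop; length-++; drop-drop; take-[]; ++-assoc)
  open import Data.Nat using (zero; suc; _+_; _∸_; _≤_; s≤s)
  open import Data.Nat.Properties using (+-comm; m+n∸m≡n; ∸-monoˡ-≤)
  open import Relation.Binary.PropositionalEquality using (_≡_; refl; cong; cong₂; sym; subst; module ≡-Reasoning)

  take-+ : ∀ r i (xs : List A) → take (r + i) xs ≡ take r xs ++ take i (drop r xs)
  take-+ zero i xs = refl
  take-+ (suc r) i [] = sym (take-[] i)
  take-+ (suc r) i (x ∷ xs) = cong (x ∷_) (take-+ r i xs)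

  take-++ˡ : ∀ i (ys zs : List A) → i ≤ length ys → take i (ys ++ zs) ≡ take i ys
  take-++ˡ zero ys zs _ = refl
  take-++ˡ (suc i) (y ∷ ys) zs (s≤s i≤n) = cong (y ∷_) (take-++ˡ i ys zs i≤n)

  take-++ʳ : ∀ (ys : List A) t zs → take (length ys + t) (ys ++ zs) ≡ ys ++ take t zs
  take-++ʳ [] t zs = refl
  take-++ʳ (y ∷ ys) t zs = cong (y ∷_) (take-++ʳ ys t zs)

  take-length-++ : ∀ (ys zs : List A) → take (length ys) (ys ++ zs) ≡ ys
  take-length-++ [] zs = refl
  take-length-++ (y ∷ ys) zs = cong (y ∷_) (take-length-++ ys zs)

  drop-length-++ : ∀ (ys zs : List A) → drop (length ys) (ys ++ zs) ≡ zs
  drop-length-++ [] zs = refl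
  drop-length-++ (y ∷ ys) zs = drop-length-++ ys zs

  drop-++ˡ : ∀ s (ys zs : List A) → s ≤ length ys → drop s (ys ++ zs) ≡ drop s ys ++ zs
  drop-++ˡ zero ys zs _ = refl
  drop-++ˡ (suc s) (y ∷ ys) zs (s≤s s≤n) = drop-++ˡ s ys zs s≤n

  rotate : ℕ → List A → List A
  rotate r xs = drop r xs ++ take r xs

  length-rotate : ∀ r (xs : List A) → length (rotate r xs) ≡ length xs
  length-rotate r xs = begin
    length (drop r xs ++ take r xs)          ≡⟨ length-++ (drop r xs) ⟩
    length (drop r xs) + length (take r xs)  ≡⟨ +-comm (length (drop r xs)) _ ⟩
    length (take r xs) + length (drop r xs)  ≡⟨ length-++ (take r xs) ⟨
    length (take r xs ++ drop r xs)          ≡⟨ cong length (take++drop≡id r xs) ⟩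
    length xs                                ∎
    where open ≡-Reasoning

  rotate-inverse : ∀ r (xs : List A) → r ≤ length xs → rotate (length xs ∸ r) (rotate r xs) ≡ xs
  rotate-inverse r xs r≤n = begin
    rotate (length xs ∸ r) (d ++ t)                              ≡⟨ cong (λ s → rotate s (d ++ t)) (length-drop r xs) ⟨
    drop (length d) (d ++ t) ++ take (length d) (d ++ t)         ≡⟨ cong₂ _++_ (drop-length-++ d t) (take-length-++ d t) ⟩
    t ++ d                                                       ≡⟨ take++drop≡id r xs ⟩
    xs                                                           ∎
    where
    open ≡-Reasoning
    d = drop r xs
    t = take r xs

  rotate-rotate : ∀ r s (xs : List A) → r + s ≤ length xs → rotate s (rotate r xs) ≡ rotate (r + s) xs
  rotate-rotate r s xs r+s≤n = begin
    drop s (d ++ t) ++ take s (d ++ t)   ≡⟨ cong₂ _++_ (drop-++ˡ s d t s≤d) (take-++ˡ s d t s≤d) ⟩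
    (drop s d ++ t) ++ take s d          ≡⟨ ++-assoc (drop s d) t (take s d) ⟩
    drop s d ++ (t ++ take s d)          ≡⟨ cong₂ _++_ (drop-drop r s xs) (sym (take-+ r s xs)) ⟩
    rotate (r + s) xs                    ∎
    where
    open ≡-Reasoning
    d = drop r xs
    t = take r xs
    s≤d : s ≤ length d
    s≤d = subst (s ≤_) (sym (length-drop r xs)) (subst (_≤ length xs ∸ r) (m+n∸m≡n r s) (∸-monoˡ-≤ r r+s≤n))


module Argmin where

  open import Data.Integer as ℤ using (ℤ; +_)
  import Data.Integer.Properties as ℤ
  import Data.Integer.Tactic.RingSolver as ℤ-Solver
  open import Data.Nat using (zero; suc; _+_; _≤_; _<_; z≤n; s≤s)
  open import Data.Nat.Properties using (≤-refl; ≤-pred; m≤n⇒m≤1+n; m≤n⇒m<n∨m≡n)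
  open import Data.Sum using (inj₁; inj₂)
  open import Relation.Binary.PropositionalEquality using (_≡_; refl; cong; cong₂; sym; trans; subst)
  open import Relation.Nullary using (yes; no)

  argmin : (ℕ → ℤ) → ℕ → ℕ
  argmin f zero = zero
  argmin f (suc n) with f (suc n) ℤ.<? f (argmin f n)
  ... | yes _ = suc n
  ... | no _ = argmin f n

  argmin≤ : ∀ (f : ℕ → ℤ) n → argmin f n ≤ n
  argmin≤ f zero = z≤n
  argmin≤ f (suc n) with f (suc n) ℤ.<? f (argmin f n)
  ... | yes _ = ≤-refl
  ... | no _ = m≤n⇒m≤1+n (argmin≤ f n)

  argmin-minimal : ∀ (f : ℕ → ℤ) n {t} → t ≤ n → f (argmin f n) ℤ.≤ f t
  argmin-minimal f zero z≤n = ℤ.≤-refl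
  argmin-minimal f (suc n) t≤1+n with f (suc n) ℤ.<? f (argmin f n) | m≤n⇒m<n∨m≡n t≤1+n
  ... | yes fn<fmin | inj₁ t<1+n = ℤ.<⇒≤ (ℤ.<-≤-trans fn<fmin (argmin-minimal f n (≤-pred t<1+n)))
  ... | yes _ | inj₂ refl = ℤ.≤-refl
  ... | no _ | inj₁ t<1+n = argmin-minimal f n (≤-pred t<1+n)
  ... | no fn≮fmin | inj₂ refl = ℤ.≮⇒≥ fn≮fmin

  argmin-first : ∀ (f : ℕ → ℤ) n {t} → t < argmin f n → f (argmin f n) ℤ.< f t
  argmin-first f (suc n) t<min with f (suc n) ℤ.<? f (argmin f n)
  ... | yes fn<fmin = ℤ.<-≤-trans fn<fmin (argmin-minimal f n (≤-pred t<min))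
  ... | no _ = argmin-first f n t<min

  [x-y]≤[z-w]⇒x+w≤z+y : ∀ x y z w → + x ℤ.- + y ℤ.≤ + z ℤ.- + w → x + w ≤ z + y
  [x-y]≤[z-w]⇒x+w≤z+y x y z w le = ℤ.drop‿+≤+ (ℤ.0≤i-j⇒j≤i (subst (ℤ._≤_ (+ 0)) difference (ℤ.i≤j⇒0≤j-i le)))
    where
    difference : (+ z ℤ.- + w) ℤ.- (+ x ℤ.- + y) ≡ + (z + y) ℤ.- + (x + w)
    difference = trans (rearrange (+ x) (+ y) (+ z) (+ w)) (sym (cong₂ ℤ._-_ (ℤ.pos-+ z y) (ℤ.pos-+ x w)))
      where
      rearrange : ∀ x y z w → (z ℤ.- w) ℤ.- (x ℤ.- y) ≡ (z ℤ.+ y) ℤ.- (x ℤ.+ w)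
      rearrange = ℤ-Solver.solve-∀

  [x-y]<[z-w]⇒x+w<z+y : ∀ x y z w → + x ℤ.- + y ℤ.< + z ℤ.- + w → x + w < z + y
  [x-y]<[z-w]⇒x+w<z+y x y z w lt = [x-y]≤[z-w]⇒x+w≤z+y (suc x) y z w (subst (ℤ._≤ + z ℤ.- + w) shift (ℤ.i<j⇒suc[i]≤j lt))
    where
    shift : ℤ.suc (+ x ℤ.- + y) ≡ + suc x ℤ.- + y
    shift = trans (rearrange (+ x) (+ y)) (cong (ℤ._- + y) (sym (ℤ.pos-+ 1 x)))
      where
      rearrange : ∀ x y → ℤ.1ℤ ℤ.+ (x ℤ.- y) ≡ (ℤ.1ℤ ℤ.+ x) ℤ.- y
      rearrange = ℤ-Solver.solve-∀


module CycleLemma {X : Set} (w : X → ℕ) where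

  open import Data.Empty using (⊥-elim)
  open import Data.Fin using (Fin; toℕ; fromℕ<)
  import Data.Fin.Properties as Fin
  open import Data.Integer as ℤ using (ℤ; +_)
  open import Data.List using (List; _++_; length; map; take; drop)
  open import Data.List.Properties using (take++drop≡id; length-drop; take-take; take-all; map-++)
  open import Data.Nat
  open import Data.Nat.ListAction using (sum)
  open import Data.Nat.ListAction.Properties using (sum-++)
  open import Data.Nat.Properties
  open import Data.Nat.Tactic.RingSolver using (solve-∀)
  open import Data.Product using (Σ; _×_; _,_)
  open import Data.Sum using (_⊎_; inj₁; inj₂)
  open import Function.Bundles using (_↔_; mk↔ₛ′)
  open import Relation.Binary.Definitions using (tri<; tri≈; tri>)
  open import Relation.Binary.PropositionalEquality
  open import Relation.Nullary using (¬_; yes; no)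
  open import Relation.Nullary.Decidable using (recompute)
  open ListRotation
  open Argmin

  weight : List X → ℕ
  weight xs = sum (map w xs)

  weight-++ : ∀ xs ys → weight (xs ++ ys) ≡ weight xs + weight ys
  weight-++ xs ys = trans (cong sum (map-++ w xs ys)) (sum-++ (map w xs) (map w ys))

  prefixWeight : ℕ → List X → ℕ
  prefixWeight i xs = weight (take i xs)

  weight-split : ∀ r xs → weight xs ≡ prefixWeight r xs + weight (drop r xs)
  weight-split r xs = trans (cong weight (sym (take++drop≡id r xs))) (weight-++ (take r xs) (drop r xs))

  weight-rotate : ∀ r xs → weight (rotate r xs) ≡ weight xs
  weight-rotate r xs = trans (weight-++ (drop r xs) (take r xs))
                             (trans (+-comm (weight (drop r xs)) _) (sym (weight-split r xs)))

  Dominating : ℕ → List X → Set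
  Dominating n xs = ∀ i → i ≤ n → i ≤ prefixWeight i xs

  record IsSeq (n : ℕ) (xs : List X) : Set where
    constructor isSeq
    field
      .length≡ : length xs ≡ suc n
      .weight≡ : weight xs ≡ n

  record IsDominatingSeq (n : ℕ) (xs : List X) : Set where
    constructor isDominatingSeq
    field
      .length≡ : length xs ≡ suc n
      .weight≡ : weight xs ≡ n
      .dominating : Dominating n xs

  Seq : ℕ → Set
  Seq n = Σ (List X) (IsSeq n)

  DominatingSeq : ℕ → Set
  DominatingSeq n = Σ (List X) (IsDominatingSeq n)

  -- If xs and its rotation by s both dominated, the first s entries would weigh at least s and
  -- the other n + 1 − s at least n + 1 − s: more than the total n.
  ¬dominating-rotate : ∀ {n xs} → length xs ≡ suc n → weight xs ≡ n → Dominating n xs → ∀ {s} → 0 < s → s ≤ n → ¬ Dominating n (rotate s xs)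
  ¬dominating-rotate {n} {xs} length≡ weight≡ dom {s} 0<s s≤n dom-rot = <-irrefl refl (begin-strict
    suc n                           ≡⟨ m∸n+n≡m (m≤n⇒m≤1+n s≤n) ⟨
    (suc n ∸ s) + s                 ≤⟨ +-mono-≤ tail-dominates (dom s s≤n) ⟩
    weight d + prefixWeight s xs    ≡⟨ +-comm (weight d) _ ⟩
    prefixWeight s xs + weight d    ≡⟨ weight-split s xs ⟨
    weight xs                       ≡⟨ weight≡ ⟩
    n                               <⟨ n<1+n n ⟩
    suc n                           ∎)
    where
    open ≤-Reasoning
    d = drop s xs
    length-d : length d ≡ suc n ∸ s
    length-d = trans (length-drop s xs) (cong (_∸ s) length≡)
    tail-dominates : suc n ∸ s ≤ weight d
    tail-dominates = subst₂ _≤_ length-d (cong weight (take-length-++ d (take s xs)))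
                            (dom-rot (length d) (subst (_≤ n) (sym length-d) (1+n∸s≤n 0<s s≤n)))
      where
      1+n∸s≤n : ∀ {s} → 0 < s → s ≤ n → suc n ∸ s ≤ n
      1+n∸s≤n {suc s} _ _ = m∸n≤m n s

  later-rotation-not-dominating : ∀ {n xs} → length xs ≡ suc n → weight xs ≡ n → ∀ {r r′} → r < r′ → r′ ≤ n → Dominating n (rotate r xs) → ¬ Dominating n (rotate r′ xs)
  later-rotation-not-dominating {n} {xs} length≡ weight≡ {r} {r′} r<r′ r′≤n dom dom′ =
    ¬dominating-rotate (trans (length-rotate r xs) length≡) (trans (weight-rotate r xs) weight≡) dom
                       (m<n⇒0<n∸m r<r′) (≤-trans (m∸n≤m r′ r) r′≤n)
                       (subst (Dominating n) (sym (trans (rotate-rotate r (r′ ∸ r) xs r+[r′∸r]≤len) (cong (λ s → rotate s xs) r+[r′∸r]≡r′))) dom′)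
    where
    r+[r′∸r]≡r′ : r + (r′ ∸ r) ≡ r′
    r+[r′∸r]≡r′ = m+[n∸m]≡n (<⇒≤ r<r′)
    r+[r′∸r]≤len : r + (r′ ∸ r) ≤ length xs
    r+[r′∸r]≤len = subst₂ _≤_ (sym r+[r′∸r]≡r′) (sym length≡) (m≤n⇒m≤1+n r′≤n)

  dominating-rotation-unique : ∀ {n xs} → length xs ≡ suc n → weight xs ≡ n → ∀ {r r′} → r ≤ n → r′ ≤ n → Dominating n (rotate r xs) → Dominating n (rotate r′ xs) → r ≡ r′
  dominating-rotation-unique {n} {xs} length≡ weight≡ {r} {r′} r≤n r′≤n dom dom′ with <-cmp r r′
  ... | tri≈ _ r≡r′ _ = r≡r′
  ... | tri< r<r′ _ _ = ⊥-elim (later-rotation-not-dominating length≡ weight≡ r<r′ r′≤n dom dom′)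
  ... | tri> _ _ r′<r = ⊥-elim (later-rotation-not-dominating length≡ weight≡ r′<r r≤n dom′ dom)

  excess : List X → ℕ → ℤ
  excess xs i = + prefixWeight i xs ℤ.- + i

  -- Rotating xs to start at the first minimum r of its excess makes it dominating.
  module Pivot {n : ℕ} {xs : List X} (length≡ : length xs ≡ suc n) (weight≡ : weight xs ≡ n) where

    r : ℕ
    r = argmin (excess xs) n

    r≤n : r ≤ n
    r≤n = argmin≤ (excess xs) n

    d e : List X
    d = drop r xs
    e = take r xs

    A D : ℕ
    A = prefixWeight r xs
    D = weight d

    A+D≡n : A + D ≡ n
    A+D≡n = trans (sym (weight-split r xs)) weight≡

    L+r≡1+n : length d + r ≡ suc n
    L+r≡1+n = trans (cong (_+ r) (trans (length-drop r xs) (cong (_∸ r) length≡))) (m∸n+n≡m (m≤n⇒m≤1+n r≤n))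

    minimal : ∀ {t} → t ≤ n → A + t ≤ prefixWeight t xs + r
    minimal {t} t≤n = [x-y]≤[z-w]⇒x+w≤z+y A r (prefixWeight t xs) t (argmin-minimal (excess xs) n t≤n)

    first : ∀ {t} → t < r → A + t < prefixWeight t xs + r
    first {t} t<r = [x-y]<[z-w]⇒x+w<z+y A r (prefixWeight t xs) t (argmin-first (excess xs) n t<r)

    within : ∀ {i} → r + i ≤ n → i ≤ weight (take i d)
    within {i} r+i≤n = +-cancelˡ-≤ (A + r) i B (subst₂ _≤_ (reorder₁ A r i) (reorder₂ A B r) (begin
      A + (r + i)                   ≤⟨ minimal r+i≤n ⟩
      prefixWeight (r + i) xs + r   ≡⟨ cong (λ ys → weight ys + r) (take-+ r i xs) ⟩
      weight (e ++ take i d) + r    ≡⟨ cong (_+ r) (weight-++ e (take i d)) ⟩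
      (A + B) + r                   ∎))
      where
      open ≤-Reasoning
      B = weight (take i d)
      reorder₁ : ∀ A r i → A + (r + i) ≡ (A + r) + i
      reorder₁ = solve-∀
      reorder₂ : ∀ A B r → (A + B) + r ≡ (A + r) + B
      reorder₂ = solve-∀

    whole : 0 < r → length d ≤ D
    whole 0<r = +-cancelʳ-≤ r (length d) D (begin
      length d + r    ≡⟨ L+r≡1+n ⟩
      suc n           ≡⟨ cong suc A+D≡n ⟨
      suc A + D       ≤⟨ +-monoˡ-≤ D (subst (_≤ r) (cong suc (+-identityʳ A)) (first 0<r)) ⟩
      r + D           ≡⟨ +-comm r D ⟩
      D + r           ∎)
      where open ≤-Reasoning

    wrapped : ∀ {t} → t < r → length d + t ≤ D + prefixWeight t xs
    wrapped {t} t<r = +-cancelʳ-≤ (suc A) _ _ (begin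
      (length d + t) + suc A            ≡⟨ reorder₁ (length d) t A ⟩
      length d + suc (A + t)            ≤⟨ +-monoʳ-≤ (length d) (first t<r) ⟩
      length d + (prefixWeight t xs + r) ≡⟨ reorder₂ (length d) (prefixWeight t xs) r ⟩
      prefixWeight t xs + (length d + r) ≡⟨ cong (_+_ (prefixWeight t xs)) (trans L+r≡1+n (cong suc (sym A+D≡n))) ⟩
      prefixWeight t xs + suc (A + D)   ≡⟨ reorder₃ (prefixWeight t xs) A D ⟩
      (D + prefixWeight t xs) + suc A   ∎)
      where
      open ≤-Reasoning
      reorder₁ : ∀ L t A → (L + t) + suc A ≡ L + suc (A + t)
      reorder₁ = solve-∀
      reorder₂ : ∀ L T r → L + (T + r) ≡ T + (L + r)
      reorder₂ = solve-∀
      reorder₃ : ∀ T A D → T + suc (A + D) ≡ (D + T) + suc A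
      reorder₃ = solve-∀

    dominating : Dominating n (rotate r xs)
    dominating i i≤n with i ≤? length d
    ... | yes i≤L = subst (i ≤_) (cong weight (sym (take-++ˡ i d e i≤L))) (no-wrap (m≤n⇒m<n∨m≡n r+i≤1+n))
      where
      r+i≤1+n : r + i ≤ suc n
      r+i≤1+n = subst (r + i ≤_) (trans (+-comm r (length d)) L+r≡1+n) (+-monoʳ-≤ r i≤L)
      no-wrap : r + i < suc n ⊎ r + i ≡ suc n → i ≤ weight (take i d)
      no-wrap (inj₁ r+i<1+n) = within (≤-pred r+i<1+n)
      no-wrap (inj₂ r+i≡1+n) = subst₂ (λ j ys → j ≤ weight ys) (sym i≡L) (sym (take-all i d (≤-reflexive (sym i≡L)))) (whole 0<r)
        where
        i≡L : i ≡ length d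
        i≡L = +-cancelˡ-≡ r i (length d) (trans r+i≡1+n (trans (sym L+r≡1+n) (+-comm (length d) r)))
        0<r : 0 < r
        0<r = n≢0⇒n>0 λ r≡0 → ≤⇒≯ i≤n (≤-reflexive (trans (sym r+i≡1+n) (cong (_+ i) r≡0)))
    ... | no i≰L = subst (_≤ prefixWeight i (rotate r xs)) L+t≡i (subst (length d + t ≤_) (sym wrapped-weight) (wrapped t<r))
      where
      t = i ∸ length d
      L+t≡i : length d + t ≡ i
      L+t≡i = m+[n∸m]≡n (<⇒≤ (≰⇒> i≰L))
      t<r : t < r
      t<r = +-cancelˡ-< (length d) t r (subst₂ _<_ (sym L+t≡i) (sym L+r≡1+n) (s≤s i≤n))
      wrapped-weight : prefixWeight i (d ++ e) ≡ D + prefixWeight t xs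
      wrapped-weight = begin
        weight (take i (d ++ e))              ≡⟨ cong (λ j → weight (take j (d ++ e))) L+t≡i ⟨
        weight (take (length d + t) (d ++ e)) ≡⟨ cong weight (take-++ʳ d t e) ⟩
        weight (d ++ take t e)                ≡⟨ weight-++ d (take t e) ⟩
        D + weight (take t e)                 ≡⟨ cong (λ ys → D + weight ys) (trans (take-take t r xs) (cong (λ j → take j xs) (m≤n⇒m⊓n≡m (<⇒≤ t<r)))) ⟩
        D + prefixWeight t xs                 ∎
        where open ≡-Reasoning

  seq-≡ : ∀ {n xs ys} {p : IsSeq n xs} {q : IsSeq n ys} → xs ≡ ys → _≡_ {A = Seq n} (xs , p) (ys , q)
  seq-≡ refl = refl

  dominatingSeq-≡ : ∀ {n xs ys} {p : IsDominatingSeq n xs} {q : IsDominatingSeq n ys} → xs ≡ ys →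
                    _≡_ {A = DominatingSeq n} (xs , p) (ys , q)
  dominatingSeq-≡ refl = refl

  -- The cycle lemma: each sequence has exactly one dominating rotation.
  rotations↔ : ∀ n → (Fin (suc n) × DominatingSeq n) ↔ Seq n
  rotations↔ n = mk↔ₛ′ to from to∘from from∘to
    where
    to : Fin (suc n) × DominatingSeq n → Seq n
    to (i , ys , isDominatingSeq length≡ weight≡ _) =
      rotate (suc n ∸ toℕ i) ys , isSeq (trans (length-rotate (suc n ∸ toℕ i) ys) length≡) (trans (weight-rotate (suc n ∸ toℕ i) ys) weight≡)
    pivot<1+n : ∀ xs → argmin (excess xs) n < suc n
    pivot<1+n xs = s≤s (argmin≤ (excess xs) n)
    from : Seq n → Fin (suc n) × DominatingSeq n
    from (xs , isSeq length≡ weight≡) =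
      fromℕ< (pivot<1+n xs) ,
      rotate (argmin (excess xs) n) xs ,
      isDominatingSeq (trans (length-rotate (argmin (excess xs) n) xs) length≡) (trans (weight-rotate (argmin (excess xs) n) xs) weight≡)
                      (Pivot.dominating (recompute (length xs ≟ suc n) length≡) (recompute (weight xs ≟ n) weight≡))
    to∘from : ∀ x → to (from x) ≡ x
    to∘from (xs , isSeq length≡ weight≡) = seq-≡ (begin
      rotate (suc n ∸ toℕ (fromℕ< (pivot<1+n xs))) (rotate r xs) ≡⟨ cong (λ j → rotate (suc n ∸ j) (rotate r xs)) (Fin.toℕ-fromℕ< (pivot<1+n xs)) ⟩
      rotate (suc n ∸ r) (rotate r xs)                         ≡⟨ cong (λ m → rotate (m ∸ r) (rotate r xs)) length≡′ ⟨
      rotate (length xs ∸ r) (rotate r xs)                     ≡⟨ rotate-inverse r xs (subst (r ≤_) (sym length≡′) (<⇒≤ (pivot<1+n xs))) ⟩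
      xs                                                       ∎)
      where
      open ≡-Reasoning
      r = argmin (excess xs) n
      length≡′ : length xs ≡ suc n
      length≡′ = recompute (length xs ≟ suc n) length≡
    from∘to : ∀ x → from (to x) ≡ x
    from∘to (i , ys , isDominatingSeq length≡ weight≡ dom) =
      cong₂ _,_ (Fin.toℕ-injective (trans (Fin.toℕ-fromℕ< (pivot<1+n xs)) r≡i)) (dominatingSeq-≡ (trans (cong (λ j → rotate j xs) r≡i) rotate-back))
      where
      length≡′ : length ys ≡ suc n
      length≡′ = recompute (length ys ≟ suc n) length≡
      weight≡′ : weight ys ≡ n
      weight≡′ = recompute (weight ys ≟ n) weight≡
      i≤1+n : toℕ i ≤ suc n
      i≤1+n = <⇒≤ (Fin.toℕ<n i)
      xs = rotate (suc n ∸ toℕ i) ys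
      length-xs : length xs ≡ suc n
      length-xs = trans (length-rotate (suc n ∸ toℕ i) ys) length≡′
      weight-xs : weight xs ≡ n
      weight-xs = trans (weight-rotate (suc n ∸ toℕ i) ys) weight≡′
      rotate-back : rotate (toℕ i) xs ≡ ys
      rotate-back = trans (cong (λ j → rotate j xs) (sym (trans (cong (_∸ (suc n ∸ toℕ i)) length≡′) (m∸[m∸n]≡n i≤1+n))))
                          (rotate-inverse (suc n ∸ toℕ i) ys (subst (suc n ∸ toℕ i ≤_) (sym length≡′) (m∸n≤m (suc n) (toℕ i))))
      r≡i : argmin (excess xs) n ≡ toℕ i
      r≡i = recompute (argmin (excess xs) n ≟ toℕ i)
              (dominating-rotation-unique length-xs weight-xs (argmin≤ (excess xs) n) (≤-pred (Fin.toℕ<n i))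
                                          (Pivot.dominating length-xs weight-xs) (subst (Dominating n) (sym rotate-back) dom))


module Flattening (k : ℕ) where

  open import Data.List using (List; []; _∷_; length)
  open import Data.Nat using (zero; suc; _*_; _+_; _≟_)
  open import Data.Nat.Properties using (suc-injective)
  open import Data.Product using (_,_)
  open import Data.Vec using (Vec; []; _++_; take; drop; replicate)
  import Data.Vec as Vec
  import Data.Vec.Properties as Vec
  open import Function.Bundles using (_↔_; mk↔ₛ′)
  open import Relation.Binary.PropositionalEquality using (_≡_; refl; cong; cong₂; sym; trans)
  open import Relation.Nullary.Decidable using (recompute)
  open StarsAndBars using (Compositions; composition-≡)
  open CycleLemma {Vec ℕ k} Vec.sum

  -- Missing blocks are filled with zero vectors.
  flatten : ∀ a → List (Vec ℕ k) → Vec ℕ (a * k)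
  flatten zero _ = []
  flatten (suc a) [] = replicate k 0 ++ flatten a []
  flatten (suc a) (v ∷ vs) = v ++ flatten a vs

  unflatten : ∀ a → Vec ℕ (a * k) → List (Vec ℕ k)
  unflatten zero _ = []
  unflatten (suc a) v = take k v ∷ unflatten a (drop k v)

  take-++ : ∀ {m} (u : Vec ℕ k) (v : Vec ℕ m) → take k (u ++ v) ≡ u
  take-++ u v = Vec.++-injectiveˡ (take k (u ++ v)) u (Vec.take++drop≡id k (u ++ v))

  drop-++ : ∀ {m} (u : Vec ℕ k) (v : Vec ℕ m) → drop k (u ++ v) ≡ v
  drop-++ u v = Vec.++-injectiveʳ (take k (u ++ v)) u (Vec.take++drop≡id k (u ++ v))

  unflatten-flatten : ∀ a vs → length vs ≡ a → unflatten a (flatten a vs) ≡ vs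
  unflatten-flatten zero [] _ = refl
  unflatten-flatten (suc a) (v ∷ vs) eq =
    cong₂ _∷_ (take-++ v (flatten a vs)) (trans (cong (unflatten a) (drop-++ v (flatten a vs))) (unflatten-flatten a vs (suc-injective eq)))

  flatten-unflatten : ∀ a v → flatten a (unflatten a v) ≡ v
  flatten-unflatten zero [] = refl
  flatten-unflatten (suc a) v = trans (cong (take k v ++_) (flatten-unflatten a (drop k v))) (Vec.take++drop≡id k v)

  length-unflatten : ∀ a v → length (unflatten a v) ≡ a
  length-unflatten zero v = refl
  length-unflatten (suc a) v = cong suc (length-unflatten a (drop k v))

  sum-flatten : ∀ a vs → length vs ≡ a → Vec.sum (flatten a vs) ≡ weight vs
  sum-flatten zero [] _ = refl
  sum-flatten (suc a) (v ∷ vs) eq = trans (Vec.sum-++ v) (cong (Vec.sum v +_) (sum-flatten a vs (suc-injective eq)))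

  seq↔compositions : ∀ n → Seq n ↔ Compositions (suc n * k) n
  seq↔compositions n = mk↔ₛ′ to from to∘from from∘to
    where
    a = suc n
    to : Seq n → Compositions (a * k) n
    to (vs , isSeq length≡ weight≡) = flatten a vs , recompute (Vec.sum (flatten a vs) ≟ n) (trans (sum-flatten a vs length≡) weight≡)
    from : Compositions (a * k) n → Seq n
    from (v , sum≡) = unflatten a v , isSeq (length-unflatten a v)
                                             (trans (sym (sum-flatten a (unflatten a v) (length-unflatten a v))) (trans (cong Vec.sum (flatten-unflatten a v)) sum≡))
    to∘from : ∀ c → to (from c) ≡ c
    to∘from (v , _) = composition-≡ (flatten-unflatten a v)
    from∘to : ∀ s → from (to s) ≡ s
    from∘to (vs , isSeq length≡ _) = seq-≡ (unflatten-flatten a vs (recompute (length vs ≟ a) length≡))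


module FlowCoordinates where

  open import Data.Bool using (if_then_else_)
  open import Data.Fin using (Fin; toℕ)
  open import Data.Integer using (ℤ; +_; -_; _+_; _-_; _*_)
  import Data.Integer.Properties as ℤ
  open import Data.Integer.Tactic.RingSolver using (solve-∀)
  open import Data.List using ([]; _∷_; length)
  open import Data.Nat as ℕ using (zero; suc; _∸_; _≟_; _<?_)
  import Data.Nat.Properties as ℕ
  open import Data.Product using (_,_)
  open import Data.Vec using (Vec; lookup) renaming ([] to []ᵥ; _∷_ to _∷ᵥ_)
  import Data.Vec.Properties as Vec
  open import Relation.Binary.Definitions using (tri<; tri≈; tri>)
  open import Relation.Binary.PropositionalEquality
  open import Relation.Nullary using (does)
  open import Relation.Nullary.Decidable using (dec-true; dec-false)
  open import Defs

  δ : ℕ → ℕ → ℤ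
  δ p s = if does (p ≟ s) then + 1 else + 0

  δ-refl : ∀ p → δ p p ≡ + 1
  δ-refl p rewrite dec-true (p ≟ p) refl = refl

  δ-≢ : ∀ {p s} → p ≢ s → δ p s ≡ + 0
  δ-≢ {p} {s} p≢s rewrite dec-false (p ≟ s) p≢s = refl

  outflow : (E : Edges) → Vec ℕ (length E) → ℕ → ℤ
  outflow [] []ᵥ p = + 0
  outflow ((s , t) ∷ E) (x ∷ᵥ c) p = + x * (δ p s - δ p t) + outflow E c p

  lookup-ε : ∀ n s (i : Fin n) → lookup (ε n s) i ≡ δ (toℕ i) s
  lookup-ε n s i = Vec.lookup∘tabulate _ i

  lookup-α : ∀ n s t (i : Fin n) → lookup (ε n s -ᵛ ε n t) i ≡ δ (toℕ i) s - δ (toℕ i) t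
  lookup-α n s t i = trans (Vec.lookup-zipWith _-_ i (ε n s) (ε n t)) (cong₂ _-_ (lookup-ε n s i) (lookup-ε n t i))

  lookup-flow : ∀ n E c (i : Fin n) → lookup (flow n E c) i ≡ outflow E c (toℕ i)
  lookup-flow n [] []ᵥ i = Vec.lookup-replicate i (+ 0)
  lookup-flow n ((s , t) ∷ E) (x ∷ᵥ c) i = begin
    lookup ((x ·ᵛ αₑ n (s , t)) +ᵛ flow n E c) i                  ≡⟨ Vec.lookup-zipWith _+_ i (x ·ᵛ αₑ n (s , t)) (flow n E c) ⟩
    lookup (x ·ᵛ αₑ n (s , t)) i + lookup (flow n E c) i         ≡⟨ cong₂ _+_ (Vec.lookup-map i (+ x *_) (αₑ n (s , t))) (lookup-flow n E c i) ⟩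
    + x * lookup (αₑ n (s , t)) i + outflow E c (toℕ i)          ≡⟨ cong (λ y → + x * y + outflow E c (toℕ i)) (lookup-α n s t i) ⟩
    outflow ((s , t) ∷ E) (x ∷ᵥ c) (toℕ i)                       ∎
    where open ≡-Reasoning

  lookup-extensionality : ∀ {A : Set} {n} (u v : Vec A n) → (∀ i → lookup u i ≡ lookup v i) → u ≡ v
  lookup-extensionality u v u≗v = trans (sym (Vec.tabulate∘lookup u)) (trans (Vec.tabulate-cong u≗v) (Vec.tabulate∘lookup v))

  ∑ : ℕ → (ℕ → ℤ) → ℤ
  ∑ zero g = + 0
  ∑ (suc m) g = ∑ m g + g m

  lookup-sumTo : ∀ {n} m (f : ℕ → Vec ℤ n) (i : Fin n) → lookup (sumTo m f) i ≡ ∑ m (λ j → lookup (f j) i)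
  lookup-sumTo zero f i = Vec.lookup-replicate i (+ 0)
  lookup-sumTo (suc m) f i = trans (Vec.lookup-zipWith _+_ i (sumTo m f) (f m)) (cong (_+ lookup (f m) i) (lookup-sumTo m f i))

  ∑-cong : ∀ m {g h : ℕ → ℤ} → (∀ j → g j ≡ h j) → ∑ m g ≡ ∑ m h
  ∑-cong zero g≗h = refl
  ∑-cong (suc m) g≗h = cong₂ _+_ (∑-cong m g≗h) (g≗h m)

  ∑-distrib-- : ∀ m (g h : ℕ → ℤ) → ∑ m (λ j → g j - h j) ≡ ∑ m g - ∑ m h
  ∑-distrib-- zero g h = refl
  ∑-distrib-- (suc m) g h = trans (cong (_+ (g m - h m)) (∑-distrib-- m g h)) (regroup (∑ m g) (∑ m h) (g m) (h m))
    where
    regroup : ∀ x y z w → (x - y) + (z - w) ≡ (x + z) - (y + w)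
    regroup = solve-∀

  ∑-δ : ∀ m (g : ℕ → ℤ) p → ∑ m (λ j → g j * δ p j) ≡ (if does (p <? m) then g p else + 0)
  ∑-δ zero g p = refl
  ∑-δ (suc m) g p with ℕ.<-cmp p m
  ... | tri< p<m _ _ rewrite ∑-δ m g p | dec-true (p <? m) p<m | dec-true (p <? suc m) (ℕ.m<n⇒m<1+n p<m)
                           | δ-≢ (ℕ.<⇒≢ p<m) = trans (cong (_+_ (g p)) (ℤ.*-zeroʳ (g m))) (ℤ.+-identityʳ (g p))
  ... | tri≈ _ refl _ rewrite ∑-δ p g p | dec-false (p <? p) (ℕ.<-irrefl refl) | dec-true (p <? suc p) (ℕ.n<1+n p)
                           | δ-refl p = trans (ℤ.+-identityˡ _) (ℤ.*-identityʳ (g p))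
  ... | tri> _ _ m<p rewrite ∑-δ m g p | dec-false (p <? m) (ℕ.<⇒≯ m<p) | dec-false (p <? suc m) (ℕ.≤⇒≯ m<p)
                           | δ-≢ (ℕ.>⇒≢ m<p) = trans (ℤ.+-identityˡ _) (ℤ.*-zeroʳ (g m))

  targetAt : ℕ → ℕ → ℤ
  targetAt M zero = + M
  targetAt M (suc q) = if does (q <? M) then - + 1 else + 0

  lookup-targetVec : ∀ a (i : Fin (suc (suc a))) → lookup (targetVec a) i ≡ targetAt (a ∸ 1) (toℕ i)
  lookup-targetVec a i = begin
    lookup (targetVec a) i                                   ≡⟨ lookup-sumTo M (λ j → (M ∸ j) ·ᵛ α n j) i ⟩
    ∑ M (λ j → lookup ((M ∸ j) ·ᵛ α n j) i)                  ≡⟨ ∑-cong M coordinate ⟩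
    ∑ M (λ j → c j * δ p j - c j * δ p (suc j))              ≡⟨ ∑-distrib-- M (λ j → c j * δ p j) (λ j → c j * δ p (suc j)) ⟩
    ∑ M (λ j → c j * δ p j) - ∑ M (λ j → c j * δ p (suc j))  ≡⟨ telescope p ⟩
    targetAt M p                                             ∎
    where
    open ≡-Reasoning
    n = suc (suc a)
    M = a ∸ 1
    p = toℕ i
    c : ℕ → ℤ
    c j = + (M ∸ j)
    coordinate : ∀ j → lookup ((M ∸ j) ·ᵛ α n j) i ≡ c j * δ p j - c j * δ p (suc j)
    coordinate j = trans (Vec.lookup-map i (c j *_) (α n j))
                         (trans (cong (c j *_) (lookup-α n j (suc j) i)) (distrib (c j) (δ p j) (δ p (suc j))))
      where
      distrib : ∀ x y z → x * (y - z) ≡ x * y - x * z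
      distrib = solve-∀
    ∑-zero : ∀ m → ∑ m (λ j → c j * + 0) ≡ + 0
    ∑-zero zero = refl
    ∑-zero (suc m) rewrite ∑-zero m | ℤ.*-zeroʳ (c m) = refl
    -- δ (suc q) (suc j) reduces to δ q j, so both sums are indicator sums.
    telescope : ∀ p → ∑ M (λ j → c j * δ p j) - ∑ M (λ j → c j * δ p (suc j)) ≡ targetAt M p
    telescope zero rewrite ∑-δ M c 0 | ∑-zero M = first M
      where
      first : ∀ M → (if does (0 <? M) then + (M ∸ 0) else + 0) - + 0 ≡ + M
      first zero = refl
      first (suc M) = ℤ.+-identityʳ (+ suc M)
    telescope (suc q) rewrite ∑-δ M c (suc q) | ∑-δ M c q = step q M
      where
      step : ∀ q M → (if does (suc q <? M) then + (M ∸ suc q) else + 0) - (if does (q <? M) then + (M ∸ q) else + 0)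
                     ≡ (if does (q <? M) then - + 1 else + 0)
      step q zero = refl
      step zero (suc zero) = refl
      step zero (suc (suc M)) = trans (cong (_-_ (+ suc M)) (ℤ.pos-+ 1 (suc M))) (cancel (+ suc M))
        where
        cancel : ∀ x → x - (+ 1 + x) ≡ - + 1
        cancel = solve-∀
      step (suc q) (suc M) = step q M

  targetAt-inner : ∀ {M q} → q ℕ.< M → targetAt M (suc q) ≡ + 0 - + 1
  targetAt-inner {M} {q} q<M rewrite dec-true (q <? M) q<M = refl

  targetAt-outer : ∀ {M q} → M ℕ.≤ q → targetAt M (suc q) ≡ + 0 - + 0
  targetAt-outer {M} {q} M≤q rewrite dec-false (q <? M) (ℕ.≤⇒≯ M≤q) = refl


module EdgeLabels where

  open import Data.Bool using (true; false; if_then_else_)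
  open import Data.Empty using (⊥-elim)
  open import Data.Integer using (ℤ; +_; _+_; _-_; _*_)
  import Data.Integer.Properties as ℤ
  open import Data.Integer.Tactic.RingSolver using (solve-∀)
  open import Data.List using (List; []; _∷_; _++_; length; map; concatMap; replicate; applyUpTo)
  import Data.List.Properties as List
  open import Data.Nat as ℕ using (zero; suc; _∸_; _≤_; _<_; _≟_; s≤s; z≤n)
  import Data.Nat.Properties as ℕ
  open import Data.Nat.ListAction using (sum)
  open import Data.Product using (_×_; _,_; proj₁; proj₂)
  open import Data.Vec using (Vec) renaming ([] to []ᵥ; _∷_ to _∷ᵥ_)
  import Data.Vec as Vec
  open import Function using (_∘_)
  open import Relation.Binary.PropositionalEquality
  open import Relation.Nullary using (does; yes; no)
  open import Relation.Nullary.Decidable using (dec-true; dec-false)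
  open import Defs
  open FlowCoordinates

  interval : ℕ → ℕ → List ℕ
  interval o zero = []
  interval o (suc m) = o ∷ interval (suc o) m

  applyUpTo≡interval : ∀ (f : ℕ → ℕ) o m → (∀ j → f j ≡ o ℕ.+ j) → applyUpTo f m ≡ interval o m
  applyUpTo≡interval f o zero f≗o+ = refl
  applyUpTo≡interval f o (suc m) f≗o+ =
    cong₂ _∷_ (trans (f≗o+ 0) (ℕ.+-identityʳ o)) (applyUpTo≡interval (f ∘ suc) (suc o) m (λ j → trans (f≗o+ (suc j)) (ℕ.+-suc o j)))

  length-interval : ∀ o m → length (interval o m) ≡ m
  length-interval o zero = refl
  length-interval o (suc m) = cong suc (length-interval (suc o) m)

  pathEdges : ℕ → ℕ → Edges
  pathEdges o m = map (λ i → (i , suc i)) (interval o m)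

  sinkEdges : ℕ → ℕ → ℕ → Edges
  sinkEdges t o m = map (λ i → (i , t)) (interval o m)

  Blocks : ℕ → List ℕ → Edges
  Blocks k xs = concatMap (λ i → replicate k (0 , i)) xs

  sourceEdges : ℕ → ℕ → ℕ → Edges
  sourceEdges k o m = Blocks k (interval o m)

  MCar≡ : ∀ k a → MCar k a ≡ pathEdges 1 a ++ sinkEdges (suc a) 1 (a ∸ 1) ++ sourceEdges k 1 a
  MCar≡ k a = cong₂ (λ xs ys → map (λ i → (i , suc i)) xs ++ map (λ i → (i , suc a)) ys ++ concatMap (λ i → replicate k (0 , i)) xs)
                    (range1≡interval a) (range1≡interval (a ∸ 1))
    where
    range1≡interval : ∀ m → range1 m ≡ interval 1 m
    range1≡interval m = trans (List.map-upTo suc m) (applyUpTo≡interval suc 1 m (λ j → refl))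

  placed : ℕ → List ℕ → ℕ → ℕ
  placed o [] p = 0
  placed o (x ∷ xs) p = if does (p ≟ o) then x else placed (suc o) xs p

  placed-below : ∀ o xs {p} → p < o → placed o xs p ≡ 0
  placed-below o [] p<o = refl
  placed-below o (x ∷ xs) {p} p<o rewrite dec-false (p ≟ o) (ℕ.<⇒≢ p<o) = placed-below (suc o) xs (ℕ.m<n⇒m<1+n p<o)

  placed-beyond : ∀ o xs {p} → o ℕ.+ length xs ≤ p → placed o xs p ≡ 0
  placed-beyond o [] o+n≤p = refl
  placed-beyond o (x ∷ xs) {p} o+n≤p rewrite dec-false (p ≟ o) (ℕ.>⇒≢ (ℕ.<-≤-trans (ℕ.m<m+n o (s≤s z≤n)) o+n≤p)) =
    placed-beyond (suc o) xs (subst (_≤ p) (ℕ.+-suc o (length xs)) o+n≤p)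

  placed-suc : ∀ o xs p → placed (suc o) xs (suc p) ≡ placed o xs p
  placed-suc o [] p = refl
  placed-suc o (x ∷ xs) p with does (p ≟ o)
  ... | true = refl
  ... | false = placed-suc (suc o) xs p

  placed-head : ∀ o x xs → placed o (x ∷ xs) o ≡ x
  placed-head o x xs rewrite dec-true (o ≟ o) refl = refl

  placed-tail : ∀ o x xs {p} → p ≢ o → placed o (x ∷ xs) p ≡ placed (suc o) xs p
  placed-tail o x xs {p} p≢o rewrite dec-false (p ≟ o) p≢o = refl

  placed-∷ : ∀ o x xs p → + placed o (x ∷ xs) p ≡ + x * δ p o + + placed (suc o) xs p
  placed-∷ o x xs p with p ≟ o
  ... | yes refl rewrite placed-head p x xs | δ-refl p | placed-below (suc p) xs (ℕ.n<1+n p) = unit (+ x)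
    where
    unit : ∀ x → x ≡ x * + 1 + + 0
    unit = solve-∀
  ... | no p≢o rewrite placed-tail o x xs p≢o | δ-≢ p≢o = absorb (+ x) (+ placed (suc o) xs p)
    where
    absorb : ∀ x y → y ≡ x * + 0 + y
    absorb = solve-∀

  placed-injective : ∀ o (xs ys : List ℕ) → length xs ≡ length ys → (∀ p → placed o xs p ≡ placed o ys p) → xs ≡ ys
  placed-injective o [] [] _ _ = refl
  placed-injective o (x ∷ xs) (y ∷ ys) |xs|≡|ys| xs≗ys =
    cong₂ _∷_ (subst₂ _≡_ (placed-head o x xs) (placed-head o y ys) (xs≗ys o))
              (placed-injective (suc o) xs ys (ℕ.suc-injective |xs|≡|ys|) tails)
    where
    tails : ∀ p → placed (suc o) xs p ≡ placed (suc o) ys p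
    tails p with p ≟ o
    ... | yes refl = trans (placed-below (suc p) xs (ℕ.n<1+n p)) (sym (placed-below (suc p) ys (ℕ.n<1+n p)))
    ... | no p≢o = subst₂ _≡_ (placed-tail o x xs p≢o) (placed-tail o y ys p≢o) (xs≗ys p)

  placed-interval : ∀ (h : ℕ → ℕ) o m {p} → o ≤ p → p < o ℕ.+ m → placed o (map h (interval o m)) p ≡ h p
  placed-interval h o zero o≤p p<o+0 = ⊥-elim (ℕ.<-irrefl refl (ℕ.<-≤-trans p<o+0 (subst (_≤ _) (sym (ℕ.+-identityʳ o)) o≤p)))
  placed-interval h o (suc m) {p} o≤p p<o+m with p ≟ o
  ... | yes refl = placed-head p (h p) (map h (interval (suc p) m))
  ... | no p≢o = trans (placed-tail o (h o) (map h (interval (suc o) m)) p≢o)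
                       (placed-interval h (suc o) m (ℕ.≤∧≢⇒< o≤p (≢-sym p≢o)) (subst (p <_) (ℕ.+-suc o m) p<o+m))

  placed-replicate-zero : ∀ o m p → placed o (replicate m 0) p ≡ 0
  placed-replicate-zero o zero p = refl
  placed-replicate-zero o (suc m) p with does (p ≟ o)
  ... | true = refl
  ... | false = placed-replicate-zero (suc o) m p

  LabelsOf : Edges → Set
  LabelsOf E = Vec ℕ (length E)

  splitLabels : ∀ A B → LabelsOf (A ++ B) → LabelsOf A × LabelsOf B
  splitLabels [] B c = []ᵥ , c
  splitLabels (_ ∷ A) B (x ∷ᵥ c) = let u , w = splitLabels A B c in x ∷ᵥ u , w

  joinLabels : ∀ A B → LabelsOf A → LabelsOf B → LabelsOf (A ++ B)
  joinLabels [] B []ᵥ w = w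
  joinLabels (_ ∷ A) B (x ∷ᵥ u) w = x ∷ᵥ joinLabels A B u w

  joinLabels-splitLabels : ∀ A B c → joinLabels A B (proj₁ (splitLabels A B c)) (proj₂ (splitLabels A B c)) ≡ c
  joinLabels-splitLabels [] B c = refl
  joinLabels-splitLabels (_ ∷ A) B (x ∷ᵥ c) = cong (x ∷ᵥ_) (joinLabels-splitLabels A B c)

  splitLabels-joinLabels : ∀ A B u w → splitLabels A B (joinLabels A B u w) ≡ (u , w)
  splitLabels-joinLabels [] B []ᵥ w = refl
  splitLabels-joinLabels (_ ∷ A) B (x ∷ᵥ u) w rewrite splitLabels-joinLabels A B u w = refl

  outflow-++ : ∀ A B c p → outflow (A ++ B) c p ≡ outflow A (proj₁ (splitLabels A B c)) p + outflow B (proj₂ (splitLabels A B c)) p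
  outflow-++ [] B c p = sym (ℤ.+-identityˡ _)
  outflow-++ ((s , t) ∷ A) B (x ∷ᵥ c) p =
    trans (cong (_+_ (+ x * (δ p s - δ p t))) (outflow-++ A B c p))
          (sym (ℤ.+-assoc (+ x * (δ p s - δ p t)) (outflow A (proj₁ (splitLabels A B c)) p) _))

  decodeMap : ∀ (φ : ℕ → ℕ × ℕ) xs → LabelsOf (map φ xs) → List ℕ
  decodeMap φ [] []ᵥ = []
  decodeMap φ (_ ∷ xs) (x ∷ᵥ c) = x ∷ decodeMap φ xs c

  -- Missing labels are filled with 0; only lists of the right length are encoded faithfully.
  encodeMap : ∀ (φ : ℕ → ℕ × ℕ) xs → List ℕ → LabelsOf (map φ xs)
  encodeMap φ [] _ = []ᵥ
  encodeMap φ (_ ∷ xs) [] = 0 ∷ᵥ encodeMap φ xs []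
  encodeMap φ (_ ∷ xs) (y ∷ ys) = y ∷ᵥ encodeMap φ xs ys

  encodeMap-decodeMap : ∀ φ xs c → encodeMap φ xs (decodeMap φ xs c) ≡ c
  encodeMap-decodeMap φ [] []ᵥ = refl
  encodeMap-decodeMap φ (_ ∷ xs) (x ∷ᵥ c) = cong (x ∷ᵥ_) (encodeMap-decodeMap φ xs c)

  decodeMap-encodeMap : ∀ φ xs ys → length ys ≡ length xs → decodeMap φ xs (encodeMap φ xs ys) ≡ ys
  decodeMap-encodeMap φ [] [] _ = refl
  decodeMap-encodeMap φ (_ ∷ xs) (y ∷ ys) eq = cong (y ∷_) (decodeMap-encodeMap φ xs ys (ℕ.suc-injective eq))

  length-decodeMap : ∀ φ xs c → length (decodeMap φ xs c) ≡ length xs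
  length-decodeMap φ [] []ᵥ = refl
  length-decodeMap φ (_ ∷ xs) (x ∷ᵥ c) = cong suc (length-decodeMap φ xs c)

  decodeBlock : ∀ k (e : ℕ × ℕ) → LabelsOf (replicate k e) → Vec ℕ k
  decodeBlock zero e []ᵥ = []ᵥ
  decodeBlock (suc k) e (x ∷ᵥ c) = x ∷ᵥ decodeBlock k e c

  encodeBlock : ∀ k (e : ℕ × ℕ) → Vec ℕ k → LabelsOf (replicate k e)
  encodeBlock zero e []ᵥ = []ᵥ
  encodeBlock (suc k) e (x ∷ᵥ v) = x ∷ᵥ encodeBlock k e v

  encodeBlock-decodeBlock : ∀ k e c → encodeBlock k e (decodeBlock k e c) ≡ c
  encodeBlock-decodeBlock zero e []ᵥ = refl
  encodeBlock-decodeBlock (suc k) e (x ∷ᵥ c) = cong (x ∷ᵥ_) (encodeBlock-decodeBlock k e c)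

  decodeBlock-encodeBlock : ∀ k e v → decodeBlock k e (encodeBlock k e v) ≡ v
  decodeBlock-encodeBlock zero e []ᵥ = refl
  decodeBlock-encodeBlock (suc k) e (x ∷ᵥ v) = cong (x ∷ᵥ_) (decodeBlock-encodeBlock k e v)

  outflow-block : ∀ k s t c p → outflow (replicate k (s , t)) c p ≡ + Vec.sum (decodeBlock k (s , t) c) * (δ p s - δ p t)
  outflow-block zero s t []ᵥ p = sym (ℤ.*-zeroˡ (δ p s - δ p t))
  outflow-block (suc k) s t (x ∷ᵥ c) p = begin
    + x * d + outflow (replicate k (s , t)) c p            ≡⟨ cong (_+_ (+ x * d)) (outflow-block k s t c p) ⟩
    + x * d + + Vec.sum (decodeBlock k (s , t) c) * d      ≡⟨ ℤ.*-distribʳ-+ d (+ x) (+ Vec.sum (decodeBlock k (s , t) c)) ⟨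
    (+ x + + Vec.sum (decodeBlock k (s , t) c)) * d        ≡⟨ cong (_* d) (ℤ.pos-+ x (Vec.sum (decodeBlock k (s , t) c))) ⟨
    + Vec.sum (decodeBlock (suc k) (s , t) (x ∷ᵥ c)) * d  ∎
    where
    open ≡-Reasoning
    d = δ p s - δ p t

  decodeBlocks : ∀ k xs → LabelsOf (Blocks k xs) → List (Vec ℕ k)
  decodeBlocks k [] []ᵥ = []
  decodeBlocks k (i ∷ xs) c = let u , w = splitLabels (replicate k (0 , i)) (Blocks k xs) c
                              in decodeBlock k (0 , i) u ∷ decodeBlocks k xs w

  -- Missing blocks are filled with zero vectors.
  encodeBlocks : ∀ k xs → List (Vec ℕ k) → LabelsOf (Blocks k xs)
  encodeBlocks k [] _ = []ᵥ
  encodeBlocks k (i ∷ xs) [] = joinLabels (replicate k (0 , i)) (Blocks k xs) (encodeBlock k (0 , i) (Vec.replicate k 0)) (encodeBlocks k xs [])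
  encodeBlocks k (i ∷ xs) (v ∷ vs) = joinLabels (replicate k (0 , i)) (Blocks k xs) (encodeBlock k (0 , i) v) (encodeBlocks k xs vs)

  encodeBlocks-decodeBlocks : ∀ k xs c → encodeBlocks k xs (decodeBlocks k xs c) ≡ c
  encodeBlocks-decodeBlocks k [] []ᵥ = refl
  encodeBlocks-decodeBlocks k (i ∷ xs) c =
    trans (cong₂ (joinLabels (replicate k (0 , i)) (Blocks k xs)) (encodeBlock-decodeBlock k (0 , i) _) (encodeBlocks-decodeBlocks k xs _))
          (joinLabels-splitLabels (replicate k (0 , i)) (Blocks k xs) c)

  decodeBlocks-encodeBlocks : ∀ k xs vs → length vs ≡ length xs → decodeBlocks k xs (encodeBlocks k xs vs) ≡ vs
  decodeBlocks-encodeBlocks k [] [] _ = refl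
  decodeBlocks-encodeBlocks k (i ∷ xs) (v ∷ vs) eq =
    cong₂ _∷_ (trans (cong (decodeBlock k (0 , i) ∘ proj₁) split-join) (decodeBlock-encodeBlock k (0 , i) v))
              (trans (cong (decodeBlocks k xs ∘ proj₂) split-join) (decodeBlocks-encodeBlocks k xs vs (ℕ.suc-injective eq)))
    where
    split-join = splitLabels-joinLabels (replicate k (0 , i)) (Blocks k xs) (encodeBlock k (0 , i) v) (encodeBlocks k xs vs)

  length-decodeBlocks : ∀ k xs c → length (decodeBlocks k xs c) ≡ length xs
  length-decodeBlocks k [] []ᵥ = refl
  length-decodeBlocks k (i ∷ xs) c = cong suc (length-decodeBlocks k xs _)

  outflow-pathEdges : ∀ o m c p → let f = decodeMap (λ i → (i , suc i)) (interval o m) c in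
                      outflow (pathEdges o m) c p ≡ + placed o f p - + placed (suc o) f p
  outflow-pathEdges o zero []ᵥ p = refl
  outflow-pathEdges o (suc m) (x ∷ᵥ c) p = begin
    + x * (δ p o - δ p (suc o)) + outflow (pathEdges (suc o) m) c p
      ≡⟨ cong (_+_ (+ x * (δ p o - δ p (suc o)))) (outflow-pathEdges (suc o) m c p) ⟩
    + x * (δ p o - δ p (suc o)) + (+ placed (suc o) f p - + placed (suc (suc o)) f p)
      ≡⟨ regroup (+ x) (δ p o) (δ p (suc o)) (+ placed (suc o) f p) (+ placed (suc (suc o)) f p) ⟩
    (+ x * δ p o + + placed (suc o) f p) - (+ x * δ p (suc o) + + placed (suc (suc o)) f p)
      ≡⟨ cong₂ _-_ (placed-∷ o x f p) (placed-∷ (suc o) x f p) ⟨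
    + placed o (x ∷ f) p - + placed (suc o) (x ∷ f) p ∎
    where
    open ≡-Reasoning
    f = decodeMap (λ i → (i , suc i)) (interval (suc o) m) c
    regroup : ∀ x d₁ d₂ y₁ y₂ → x * (d₁ - d₂) + (y₁ - y₂) ≡ (x * d₁ + y₁) - (x * d₂ + y₂)
    regroup = solve-∀

  outflow-sinkEdges : ∀ t o m c p → let g = decodeMap (λ i → (i , t)) (interval o m) c in
                      outflow (sinkEdges t o m) c p ≡ + placed o g p - δ p t * + sum g
  outflow-sinkEdges t o zero []ᵥ p = cong (_-_ (+ 0)) (sym (ℤ.*-zeroʳ (δ p t)))
  outflow-sinkEdges t o (suc m) (x ∷ᵥ c) p = begin
    + x * (δ p o - δ p t) + outflow (sinkEdges t (suc o) m) c p
      ≡⟨ cong (_+_ (+ x * (δ p o - δ p t))) (outflow-sinkEdges t (suc o) m c p) ⟩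
    + x * (δ p o - δ p t) + (+ placed (suc o) g p - δ p t * + sum g)
      ≡⟨ regroup (+ x) (δ p o) (δ p t) (+ placed (suc o) g p) (+ sum g) ⟩
    (+ x * δ p o + + placed (suc o) g p) - δ p t * (+ x + + sum g)
      ≡⟨ cong₂ (λ y s → y - δ p t * s) (placed-∷ o x g p) (ℤ.pos-+ x (sum g)) ⟨
    + placed o (x ∷ g) p - δ p t * + sum (x ∷ g) ∎
    where
    open ≡-Reasoning
    g = decodeMap (λ i → (i , t)) (interval (suc o) m) c
    regroup : ∀ x d₁ d₂ y s → x * (d₁ - d₂) + (y - d₂ * s) ≡ (x * d₁ + y) - d₂ * (x + s)
    regroup = solve-∀

  outflow-sourceEdges : ∀ k o m c p → let H = map Vec.sum (decodeBlocks k (interval o m) c) in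
                        outflow (sourceEdges k o m) c p ≡ δ p 0 * + sum H - + placed o H p
  outflow-sourceEdges k o zero []ᵥ p = cong (_- + 0) (sym (ℤ.*-zeroʳ (δ p 0)))
  outflow-sourceEdges k o (suc m) c p = begin
    outflow (replicate k (0 , o) ++ Blocks k (interval (suc o) m)) c p
      ≡⟨ outflow-++ (replicate k (0 , o)) (Blocks k (interval (suc o) m)) c p ⟩
    outflow (replicate k (0 , o)) u p + outflow (sourceEdges k (suc o) m) w p
      ≡⟨ cong₂ _+_ (outflow-block k 0 o u p) (outflow-sourceEdges k (suc o) m w p) ⟩
    + h * (δ p 0 - δ p o) + (δ p 0 * + sum H - + placed (suc o) H p)
      ≡⟨ regroup (+ h) (δ p 0) (δ p o) (+ placed (suc o) H p) (+ sum H) ⟩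
    δ p 0 * (+ h + + sum H) - (+ h * δ p o + + placed (suc o) H p)
      ≡⟨ cong₂ (λ s y → δ p 0 * s - y) (ℤ.pos-+ h (sum H)) (placed-∷ o h H p) ⟨
    δ p 0 * + sum (h ∷ H) - + placed o (h ∷ H) p ∎
    where
    open ≡-Reasoning
    u = proj₁ (splitLabels (replicate k (0 , o)) (Blocks k (interval (suc o) m)) c)
    w = proj₂ (splitLabels (replicate k (0 , o)) (Blocks k (interval (suc o) m)) c)
    h = Vec.sum (decodeBlock k (0 , o) u)
    H = map Vec.sum (decodeBlocks k (interval (suc o) m) w)
    regroup : ∀ x d₀ d y s → x * (d₀ - d) + (d₀ * s - y) ≡ d₀ * (x + s) - (x * d + y)
    regroup = solve-∀



module MCarSolutions where

  open import Axiom.UniquenessOfIdentityProofs using (module Decidable⇒UIP)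
  open import Data.Fin using (toℕ; fromℕ<)
  import Data.Fin.Properties as Fin
  open import Data.Integer as ℤ using (ℤ; +_; _-_)
  import Data.Integer.Properties as ℤ
  open import Data.Integer.Tactic.RingSolver using (solve-∀)
  open import Data.List using (List; []; _∷_; _++_; length; map; replicate)
  import Data.List.Properties as List
  open import Data.Nat as ℕ using (zero; suc; _+_; _∸_; _≤_; _<_; _≟_; s≤s; z≤n)
  import Data.Nat.Properties as ℕ
  open import Data.Nat.ListAction using (sum)
  import Data.Nat.Tactic.RingSolver as ℕ-Solver
  open import Data.Product using (_×_; _,_; proj₁; proj₂)
  open import Data.Vec using (Vec)
  import Data.Vec as Vec
  import Data.Vec.Properties as Vec
  open import Function using (_∘_)
  open import Function.Bundles using (_↔_; mk↔ₛ′)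
  open import Relation.Binary.Definitions using (tri<; tri≈; tri>)
  open import Relation.Binary.PropositionalEquality
  open import Relation.Nullary.Decidable using (recompute)
  open import Defs
  open FlowCoordinates
  open EdgeLabels

  [x-y]+z-w≡[c-d]⇒x+z+d≡y+w+c : ∀ x y z w c d → (+ x - + y) ℤ.+ + z - + w ≡ + c - + d → x + z + d ≡ y + w + c
  [x-y]+z-w≡[c-d]⇒x+z+d≡y+w+c x y z w c d eq = ℤ.+-injective (begin
    + (x + z + d)                                        ≡⟨ trans (ℤ.pos-+ (x + z) d) (cong (ℤ._+ + d) (ℤ.pos-+ x z)) ⟩
    + x ℤ.+ + z ℤ.+ + d                                  ≡⟨ expand (+ x) (+ y) (+ z) (+ w) (+ d) ⟩
    (+ x - + y) ℤ.+ + z - + w ℤ.+ (+ y ℤ.+ + w ℤ.+ + d)  ≡⟨ cong (ℤ._+ (+ y ℤ.+ + w ℤ.+ + d)) eq ⟩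
    + c - + d ℤ.+ (+ y ℤ.+ + w ℤ.+ + d)                  ≡⟨ collect (+ c) (+ y) (+ w) (+ d) ⟩
    + y ℤ.+ + w ℤ.+ + c                                  ≡⟨ trans (ℤ.pos-+ (y + w) c) (cong (ℤ._+ + c) (ℤ.pos-+ y w)) ⟨
    + (y + w + c)                                        ∎)
    where
    open ≡-Reasoning
    expand : ∀ x y z w d → x ℤ.+ z ℤ.+ d ≡ (x - y) ℤ.+ z - w ℤ.+ (y ℤ.+ w ℤ.+ d)
    expand = solve-∀
    collect : ∀ c y w d → c - d ℤ.+ (y ℤ.+ w ℤ.+ d) ≡ y ℤ.+ w ℤ.+ c
    collect = solve-∀

  x+z+d≡y+w+c⇒[x-y]+z-w≡[c-d] : ∀ x y z w c d → x + z + d ≡ y + w + c → (+ x - + y) ℤ.+ + z - + w ≡ + c - + d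
  x+z+d≡y+w+c⇒[x-y]+z-w≡[c-d] x y z w c d eq = begin
    (+ x - + y) ℤ.+ + z - + w                            ≡⟨ shift (+ x) (+ y) (+ z) (+ w) (+ d) ⟩
    (+ x ℤ.+ + z ℤ.+ + d) - (+ y ℤ.+ + w) - + d          ≡⟨ cong (λ t → t - (+ y ℤ.+ + w) - + d) (sums x z d) ⟩
    + (x + z + d) - (+ y ℤ.+ + w) - + d                  ≡⟨ cong (λ t → + t - (+ y ℤ.+ + w) - + d) eq ⟩
    + (y + w + c) - (+ y ℤ.+ + w) - + d                  ≡⟨ cong (λ t → t - (+ y ℤ.+ + w) - + d) (sums y w c) ⟩
    (+ y ℤ.+ + w ℤ.+ + c) - (+ y ℤ.+ + w) - + d          ≡⟨ cancel (+ y ℤ.+ + w) (+ c) (+ d) ⟩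
    + c - + d                                            ∎
    where
    open ≡-Reasoning
    sums : ∀ x z d → + (x + z + d) ≡ + x ℤ.+ + z ℤ.+ + d
    sums x z d = trans (ℤ.pos-+ (x + z) d) (cong (ℤ._+ + d) (ℤ.pos-+ x z))
    shift : ∀ x y z w d → (x - y) ℤ.+ z - w ≡ (x ℤ.+ z ℤ.+ d) - (y ℤ.+ w) - d
    shift = solve-∀
    cancel : ∀ s c d → (s ℤ.+ c) - s - d ≡ c - d
    cancel = solve-∀

  module _ (k M : ℕ) where
    open CycleLemma {Vec ℕ k} Vec.sum

    a : ℕ
    a = suc M

    Path Sink Source : Edges
    Path = pathEdges 1 a
    Sink = sinkEdges (suc a) 1 M
    Source = sourceEdges k 1 a

    E : Edges
    E = Path ++ Sink ++ Source

    pathLabels : LabelsOf E → List ℕ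
    pathLabels c = decodeMap (λ i → (i , suc i)) (interval 1 a) (proj₁ (splitLabels Path (Sink ++ Source) c))

    sinkSourceLabels : LabelsOf E → LabelsOf Sink × LabelsOf Source
    sinkSourceLabels c = splitLabels Sink Source (proj₂ (splitLabels Path (Sink ++ Source) c))

    sinkLabels : LabelsOf E → List ℕ
    sinkLabels c = decodeMap (λ i → (i , suc a)) (interval 1 M) (proj₁ (sinkSourceLabels c))

    sourceLabels : LabelsOf E → List (Vec ℕ k)
    sourceLabels c = decodeBlocks k (interval 1 a) (proj₂ (sinkSourceLabels c))

    encode : List ℕ → List ℕ → List (Vec ℕ k) → LabelsOf E
    encode f g hs = joinLabels Path (Sink ++ Source) (encodeMap (λ i → (i , suc i)) (interval 1 a) f)
                      (joinLabels Sink Source (encodeMap (λ i → (i , suc a)) (interval 1 M) g) (encodeBlocks k (interval 1 a) hs))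

    encode-decode : ∀ c → encode (pathLabels c) (sinkLabels c) (sourceLabels c) ≡ c
    encode-decode c =
      trans (cong₂ (joinLabels Path (Sink ++ Source)) (encodeMap-decodeMap (λ i → (i , suc i)) (interval 1 a) path)
                   (trans (cong₂ (joinLabels Sink Source) (encodeMap-decodeMap (λ i → (i , suc a)) (interval 1 M) sink)
                                                          (encodeBlocks-decodeBlocks k (interval 1 a) source))
                          (joinLabels-splitLabels Sink Source rest)))
            (joinLabels-splitLabels Path (Sink ++ Source) c)
      where
      path = proj₁ (splitLabels Path (Sink ++ Source) c)
      rest = proj₂ (splitLabels Path (Sink ++ Source) c)
      sink = proj₁ (splitLabels Sink Source rest)
      source = proj₂ (splitLabels Sink Source rest)

    module _ (f g : List ℕ) (hs : List (Vec ℕ k)) (length-f : length f ≡ a) (length-g : length g ≡ M) (length-hs : length hs ≡ a) where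
      private
        split-join = splitLabels-joinLabels Path (Sink ++ Source) (encodeMap (λ i → (i , suc i)) (interval 1 a) f)
                       (joinLabels Sink Source (encodeMap (λ i → (i , suc a)) (interval 1 M) g) (encodeBlocks k (interval 1 a) hs))
        sinkSource-encode : sinkSourceLabels (encode f g hs) ≡ (encodeMap (λ i → (i , suc a)) (interval 1 M) g , encodeBlocks k (interval 1 a) hs)
        sinkSource-encode = trans (cong (splitLabels Sink Source ∘ proj₂) split-join) (splitLabels-joinLabels Sink Source (encodeMap (λ i → (i , suc a)) (interval 1 M) g) (encodeBlocks k (interval 1 a) hs))

      pathLabels-encode : pathLabels (encode f g hs) ≡ f
      pathLabels-encode = trans (cong (decodeMap _ (interval 1 a) ∘ proj₁) split-join)
                                (decodeMap-encodeMap _ (interval 1 a) f (trans length-f (sym (length-interval 1 a))))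

      sinkLabels-encode : sinkLabels (encode f g hs) ≡ g
      sinkLabels-encode = trans (cong (decodeMap _ (interval 1 M) ∘ proj₁) sinkSource-encode)
                                (decodeMap-encodeMap _ (interval 1 M) g (trans length-g (sym (length-interval 1 M))))

      sourceLabels-encode : sourceLabels (encode f g hs) ≡ hs
      sourceLabels-encode = trans (cong (decodeBlocks k (interval 1 a) ∘ proj₂) sinkSource-encode)
                                  (decodeBlocks-encodeBlocks k (interval 1 a) hs (trans length-hs (sym (length-interval 1 a))))

    length-pathLabels : ∀ c → length (pathLabels c) ≡ a
    length-pathLabels c = trans (length-decodeMap (λ i → (i , suc i)) (interval 1 a) (proj₁ (splitLabels Path (Sink ++ Source) c))) (length-interval 1 a)

    length-sinkLabels : ∀ c → length (sinkLabels c) ≡ M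
    length-sinkLabels c = trans (length-decodeMap (λ i → (i , suc a)) (interval 1 M) (proj₁ (sinkSourceLabels c))) (length-interval 1 M)

    length-sourceLabels : ∀ c → length (sourceLabels c) ≡ a
    length-sourceLabels c = trans (length-decodeBlocks k (interval 1 a) (proj₂ (sinkSourceLabels c))) (length-interval 1 a)

    outflowOf : List ℕ → List ℕ → List (Vec ℕ k) → ℕ → ℤ
    outflowOf f g hs p = (+ placed 1 f p - + placed 2 f p) ℤ.+
                         ((+ placed 1 g p - δ p (suc a) ℤ.* + sum g) ℤ.+ (δ p 0 ℤ.* + weight hs - + placed 1 (map Vec.sum hs) p))

    outflow-E : ∀ c p → outflow E c p ≡ outflowOf (pathLabels c) (sinkLabels c) (sourceLabels c) p
    outflow-E c p = trans (outflow-++ Path (Sink ++ Source) c p)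
      (cong₂ ℤ._+_ (outflow-pathEdges 1 a path p)
                   (trans (outflow-++ Sink Source rest p) (cong₂ ℤ._+_ (outflow-sinkEdges (suc a) 1 M sink p) (outflow-sourceEdges k 1 a source p))))
      where
      path = proj₁ (splitLabels Path (Sink ++ Source) c)
      rest = proj₂ (splitLabels Path (Sink ++ Source) c)
      sink = proj₁ (splitLabels Sink Source rest)
      source = proj₂ (splitLabels Sink Source rest)

    outflowOf-source : ∀ f g hs → outflowOf f g hs 0 ≡ + weight hs
    outflowOf-source f g hs
      rewrite placed-below 1 f {0} (s≤s z≤n) | placed-below 2 f {0} (s≤s z≤n) | placed-below 1 g {0} (s≤s z≤n)
            | placed-below 1 (map Vec.sum hs) {0} (s≤s z≤n) = simplify (+ sum g) (+ weight hs)
      where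
      simplify : ∀ s t → (+ 0 - + 0) ℤ.+ ((+ 0 - + 0 ℤ.* s) ℤ.+ (+ 1 ℤ.* t - + 0)) ≡ t
      simplify = solve-∀

    outflowOf-inner : ∀ f g hs {q} → q < a →
                      outflowOf f g hs (suc q) ≡ (+ placed 0 f q - + placed 1 f q) ℤ.+ + placed 0 g q - + placed 0 (map Vec.sum hs) q
    outflowOf-inner f g hs {q} q<a
      rewrite placed-suc 0 f q | placed-suc 1 f q | placed-suc 0 g q | placed-suc 0 (map Vec.sum hs) q | δ-≢ {q} {a} (ℕ.<⇒≢ q<a) =
      simplify (+ placed 0 f q) (+ placed 1 f q) (+ placed 0 g q) (+ sum g) (+ weight hs) (+ placed 0 (map Vec.sum hs) q)
      where
      simplify : ∀ x y z s t w → (x - y) ℤ.+ ((z - + 0 ℤ.* s) ℤ.+ (+ 0 ℤ.* t - w)) ≡ (x - y) ℤ.+ z - w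
      simplify = solve-∀

    outflowOf-sink : ∀ f g hs → length f ≡ a → length g ≡ M → length hs ≡ a →
                     outflowOf f g hs (suc a) ≡ (+ 0 - + placed 1 f a) ℤ.+ + 0 - + sum g
    outflowOf-sink f g hs length-f length-g length-hs
      rewrite placed-suc 0 f a | placed-suc 1 f a | placed-beyond 0 f {a} (ℕ.≤-reflexive length-f)
            | placed-beyond 1 g {suc a} (s≤s (subst (_≤ a) (sym length-g) (ℕ.n≤1+n M)))
            | placed-beyond 1 (map Vec.sum hs) {suc a} (s≤s (ℕ.≤-reflexive (trans (List.length-map Vec.sum hs) length-hs)))
            | δ-refl (suc a) = simplify (+ placed 1 f a) (+ sum g) (+ weight hs)
      where
      simplify : ∀ y s t → (+ 0 - y) ℤ.+ ((+ 0 - + 1 ℤ.* s) ℤ.+ (+ 0 ℤ.* t - + 0)) ≡ (+ 0 - y) ℤ.+ + 0 - s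
      simplify = solve-∀

    prefixWeight-suc : ∀ q hs → prefixWeight (suc q) hs ≡ prefixWeight q hs + placed 0 (map Vec.sum hs) q
    prefixWeight-suc q [] = cong (λ ys → weight ys + 0) (sym (List.take-[] q))
    prefixWeight-suc zero (h ∷ hs) = ℕ.+-identityʳ (Vec.sum h)
    prefixWeight-suc (suc q) (h ∷ hs) = begin
      Vec.sum h + prefixWeight (suc q) hs                                    ≡⟨ cong (_+_ (Vec.sum h)) (prefixWeight-suc q hs) ⟩
      Vec.sum h + (prefixWeight q hs + placed 0 (map Vec.sum hs) q)          ≡⟨ ℕ.+-assoc (Vec.sum h) _ _ ⟨
      Vec.sum h + prefixWeight q hs + placed 0 (map Vec.sum hs) q            ≡⟨ cong (_+_ (Vec.sum h + prefixWeight q hs)) (placed-suc 0 (map Vec.sum hs) q) ⟨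
      Vec.sum h + prefixWeight q hs + placed 1 (map Vec.sum hs) (suc q)      ∎
      where open ≡-Reasoning

    prefixWeight-all : ∀ hs → length hs ≡ a → prefixWeight a hs ≡ weight hs
    prefixWeight-all hs length-hs = cong weight (List.take-all a hs (ℕ.≤-reflexive length-hs))

    IsSolution : List ℕ → List ℕ → List (Vec ℕ k) → Set
    IsSolution f g hs = ∀ p → p < suc (suc a) → outflowOf f g hs p ≡ targetAt M p

    -- The label of the path edge (i , i+1) forced by the source labels; at i = a the truncated
    -- subtraction gives the forced label 0.
    forcedPath : List (Vec ℕ k) → List ℕ
    forcedPath hs = map (λ i → prefixWeight i hs ∸ i) (interval 1 a)

    length-forcedPath : ∀ hs → length (forcedPath hs) ≡ a
    length-forcedPath hs = trans (List.length-map _ (interval 1 a)) (length-interval 1 a)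

    module Necessity (f g : List ℕ) (hs : List (Vec ℕ k))
                     (length-f : length f ≡ a) (length-g : length g ≡ M) (length-hs : length hs ≡ a)
                     (solution : IsSolution f g hs) where

      H : List ℕ
      H = map Vec.sum hs

      sink-empty : placed 1 f a + sum g ≡ 0
      sink-empty = sym (trans ([x-y]+z-w≡[c-d]⇒x+z+d≡y+w+c 0 (placed 1 f a) 0 (sum g) 0 0 vertex) (ℕ.+-identityʳ _))
        where
        vertex = trans (sym (outflowOf-sink f g hs length-f length-g length-hs))
                       (trans (solution (suc a) (ℕ.n<1+n (suc a))) (targetAt-outer (ℕ.n≤1+n M)))

      weight≡ : weight hs ≡ M
      weight≡ = ℤ.+-injective (trans (sym (outflowOf-source f g hs)) (solution 0 (s≤s z≤n)))

      sink≡0 : g ≡ replicate M 0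
      sink≡0 = trans (sum≡0⇒replicate g (ℕ.m+n≡0⇒n≡0 (placed 1 f a) sink-empty)) (cong (λ m → replicate m 0) length-g)
        where
        sum≡0⇒replicate : ∀ xs → sum xs ≡ 0 → xs ≡ replicate (length xs) 0
        sum≡0⇒replicate [] _ = refl
        sum≡0⇒replicate (zero ∷ xs) eq = cong (0 ∷_) (sum≡0⇒replicate xs eq)

      sink-at : ∀ q → placed 0 g q ≡ 0
      sink-at q = trans (cong (λ xs → placed 0 xs q) sink≡0) (placed-replicate-zero 0 M q)

      -- Conservation at the inner vertex q+1 (q < M) of the path.
      conservation : ∀ {q} → q < M → placed 0 f q + 1 ≡ placed 1 f q + placed 0 H q
      conservation {q} q<M = begin
        placed 0 f q + 1                   ≡⟨ cong (_+ 1) (trans (cong (_+_ (placed 0 f q)) (sink-at q)) (ℕ.+-identityʳ _)) ⟨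
        placed 0 f q + placed 0 g q + 1    ≡⟨ [x-y]+z-w≡[c-d]⇒x+z+d≡y+w+c (placed 0 f q) (placed 1 f q) (placed 0 g q) (placed 0 H q) 0 1 vertex ⟩
        placed 1 f q + placed 0 H q + 0    ≡⟨ ℕ.+-identityʳ _ ⟩
        placed 1 f q + placed 0 H q        ∎
        where
        open ≡-Reasoning
        vertex = trans (sym (outflowOf-inner f g hs (ℕ.m<n⇒m<1+n q<M)))
                       (trans (solution (suc q) (s≤s (ℕ.m<n⇒m<1+n (ℕ.m<n⇒m<1+n q<M)))) (targetAt-inner q<M))

      inflow+q≡prefixWeight : ∀ q → q ≤ M → placed 1 f q + q ≡ prefixWeight q hs
      inflow+q≡prefixWeight zero _ = trans (ℕ.+-identityʳ _) (placed-below 1 f {0} (s≤s z≤n))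
      inflow+q≡prefixWeight (suc q) q<M = begin
        placed 1 f (suc q) + suc q            ≡⟨ cong (_+ suc q) (placed-suc 0 f q) ⟩
        placed 0 f q + suc q                  ≡⟨ ℕ.+-suc (placed 0 f q) q ⟩
        suc (placed 0 f q + q)                ≡⟨ cong (_+ q) (trans (ℕ.+-comm 1 _) (conservation q<M)) ⟩
        placed 1 f q + placed 0 H q + q       ≡⟨ ℕ.+-assoc (placed 1 f q) _ q ⟩
        placed 1 f q + (placed 0 H q + q)     ≡⟨ cong (_+_ (placed 1 f q)) (ℕ.+-comm (placed 0 H q) q) ⟩
        placed 1 f q + (q + placed 0 H q)     ≡⟨ ℕ.+-assoc (placed 1 f q) q _ ⟨
        placed 1 f q + q + placed 0 H q       ≡⟨ cong (_+ placed 0 H q) (inflow+q≡prefixWeight q (ℕ.<⇒≤ q<M)) ⟩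
        prefixWeight q hs + placed 0 H q      ≡⟨ prefixWeight-suc q hs ⟨
        prefixWeight (suc q) hs               ∎
        where open ≡-Reasoning

      dominating : Dominating M hs
      dominating i i≤M = subst (i ≤_) (inflow+q≡prefixWeight i i≤M) (ℕ.m≤n+m i _)

      path≡forcedPath : f ≡ forcedPath hs
      path≡forcedPath = placed-injective 1 f (forcedPath hs) (trans length-f (sym (length-forcedPath hs))) agree
        where
        agree : ∀ p → placed 1 f p ≡ placed 1 (forcedPath hs) p
        agree zero = trans (placed-below 1 f {0} (s≤s z≤n)) (sym (placed-below 1 (forcedPath hs) {0} (s≤s z≤n)))
        agree (suc q) with ℕ.<-cmp q M
        ... | tri< q<M _ _ = trans (sym (trans (cong (_∸ suc q) (sym (inflow+q≡prefixWeight (suc q) q<M))) (ℕ.m+n∸n≡m _ (suc q))))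
                                   (sym (placed-interval _ 1 a (s≤s z≤n) (s≤s (ℕ.m<n⇒m<1+n q<M))))
        ... | tri≈ _ refl _ = trans (ℕ.m+n≡0⇒m≡0 (placed 1 f a) sink-empty)
                                    (sym (trans (placed-interval _ 1 a (s≤s z≤n) (ℕ.n<1+n a))
                                                (trans (cong (_∸ a) (trans (prefixWeight-all hs length-hs) weight≡)) (ℕ.m≤n⇒m∸n≡0 (ℕ.n≤1+n M)))))
        ... | tri> _ _ M<q = trans (placed-beyond 1 f (s≤s (subst (_≤ q) (sym length-f) M<q)))
                                   (sym (placed-beyond 1 (forcedPath hs) (s≤s (subst (_≤ q) (sym (length-forcedPath hs)) M<q))))

    module Sufficiency (hs : List (Vec ℕ k)) (length-hs : length hs ≡ a) (weight≡ : weight hs ≡ M) (dominating : Dominating M hs) where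

      H : List ℕ
      H = map Vec.sum hs

      f : List ℕ
      f = forcedPath hs

      inflow : ∀ q → q ≤ a → placed 1 f q ≡ prefixWeight q hs ∸ q
      inflow zero _ = placed-below 1 f {0} (s≤s z≤n)
      inflow (suc q) q<a = placed-interval _ 1 a (s≤s z≤n) (s≤s q<a)

      inflow+q≡prefixWeight : ∀ q → q ≤ M → placed 1 f q + q ≡ prefixWeight q hs
      inflow+q≡prefixWeight q q≤M = trans (cong (_+ q) (inflow q (ℕ.m≤n⇒m≤1+n q≤M))) (ℕ.m∸n+n≡m (dominating q q≤M))

      last-inflow : placed 1 f a ≡ 0
      last-inflow = trans (inflow a ℕ.≤-refl) (trans (cong (_∸ a) (trans (prefixWeight-all hs length-hs) weight≡)) (ℕ.m≤n⇒m∸n≡0 (ℕ.n≤1+n M)))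

      conservation : ∀ {q} → q < M → placed 0 f q + 0 + 1 ≡ placed 1 f q + placed 0 H q + 0
      conservation {q} q<M = ℕ.+-cancelʳ-≡ q _ _ (begin
        placed 0 f q + 0 + 1 + q              ≡⟨ reorder₁ (placed 0 f q) q ⟩
        placed 0 f q + suc q                  ≡⟨ cong (_+ suc q) (placed-suc 0 f q) ⟨
        placed 1 f (suc q) + suc q            ≡⟨ inflow+q≡prefixWeight (suc q) q<M ⟩
        prefixWeight (suc q) hs               ≡⟨ prefixWeight-suc q hs ⟩
        prefixWeight q hs + placed 0 H q      ≡⟨ cong (_+ placed 0 H q) (inflow+q≡prefixWeight q (ℕ.<⇒≤ q<M)) ⟨
        placed 1 f q + q + placed 0 H q       ≡⟨ reorder₂ (placed 1 f q) q (placed 0 H q) ⟩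
        placed 1 f q + placed 0 H q + 0 + q   ∎)
        where
        open ≡-Reasoning
        reorder₁ : ∀ x q → x + 0 + 1 + q ≡ x + suc q
        reorder₁ = ℕ-Solver.solve-∀
        reorder₂ : ∀ y q h → y + q + h ≡ y + h + 0 + q
        reorder₂ = ℕ-Solver.solve-∀

      last-conservation : placed 0 f M + 0 + 0 ≡ placed 1 f M + placed 0 H M + 0
      last-conservation = ℕ.+-cancelʳ-≡ M _ _ (begin
        placed 0 f M + 0 + 0 + M              ≡⟨ cong (λ x → x + 0 + 0 + M) (trans (sym (placed-suc 0 f M)) last-inflow) ⟩
        M                                     ≡⟨ trans (prefixWeight-all hs length-hs) weight≡ ⟨
        prefixWeight a hs                     ≡⟨ prefixWeight-suc M hs ⟩
        prefixWeight M hs + placed 0 H M      ≡⟨ cong (_+ placed 0 H M) (inflow+q≡prefixWeight M ℕ.≤-refl) ⟨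
        placed 1 f M + M + placed 0 H M       ≡⟨ reorder (placed 1 f M) M (placed 0 H M) ⟩
        placed 1 f M + placed 0 H M + 0 + M   ∎)
        where
        open ≡-Reasoning
        reorder : ∀ y q h → y + q + h ≡ y + h + 0 + q
        reorder = ℕ-Solver.solve-∀

      solution : IsSolution f (replicate M 0) hs
      solution zero _ = trans (outflowOf-source f (replicate M 0) hs) (cong +_ weight≡)
      solution (suc q) q<2+a with ℕ.<-cmp q M
      ... | tri< q<M _ _ = trans (outflowOf-inner f (replicate M 0) hs (ℕ.m<n⇒m<1+n q<M))
                                 (trans (cong (λ z → (+ placed 0 f q - + placed 1 f q) ℤ.+ + z - + placed 0 H q) (placed-replicate-zero 0 M q))
                                        (trans (x+z+d≡y+w+c⇒[x-y]+z-w≡[c-d] (placed 0 f q) (placed 1 f q) 0 (placed 0 H q) 0 1 (conservation q<M)) (sym (targetAt-inner q<M))))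
      ... | tri≈ _ refl _ = trans (outflowOf-inner f (replicate M 0) hs (ℕ.n<1+n M))
                                 (trans (cong (λ z → (+ placed 0 f M - + placed 1 f M) ℤ.+ + z - + placed 0 H M) (placed-replicate-zero 0 M M))
                                        (trans (x+z+d≡y+w+c⇒[x-y]+z-w≡[c-d] (placed 0 f M) (placed 1 f M) 0 (placed 0 H M) 0 0 last-conservation) (sym (targetAt-outer {M} {M} ℕ.≤-refl))))
      ... | tri> _ _ M<q rewrite ℕ.≤-antisym (ℕ.≤-pred (ℕ.≤-pred q<2+a)) M<q = trans (outflowOf-sink f (replicate M 0) hs (length-forcedPath hs) (List.length-replicate M) length-hs)
                                 (trans (cong₂ (λ x s → (+ 0 - + x) ℤ.+ + 0 - + s) last-inflow (sum-replicate-zero M))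
                                        (sym (targetAt-outer (ℕ.n≤1+n M))))
        where
        sum-replicate-zero : ∀ m → sum (replicate m 0) ≡ 0
        sum-replicate-zero zero = refl
        sum-replicate-zero (suc m) = sum-replicate-zero m

    flow≡target⇒IsSolution : ∀ c → flow (suc (suc a)) E c ≡ targetVec a → IsSolution (pathLabels c) (sinkLabels c) (sourceLabels c)
    flow≡target⇒IsSolution c eq p p<n = begin
      outflowOf (pathLabels c) (sinkLabels c) (sourceLabels c) p   ≡⟨ outflow-E c p ⟨
      outflow E c p                                                ≡⟨ cong (outflow E c) (Fin.toℕ-fromℕ< p<n) ⟨
      outflow E c (toℕ i)                                          ≡⟨ lookup-flow (suc (suc a)) E c i ⟨
      Vec.lookup (flow (suc (suc a)) E c) i                        ≡⟨ cong (λ v → Vec.lookup v i) eq ⟩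
      Vec.lookup (targetVec a) i                                   ≡⟨ lookup-targetVec a i ⟩
      targetAt M (toℕ i)                                           ≡⟨ cong (targetAt M) (Fin.toℕ-fromℕ< p<n) ⟩
      targetAt M p                                                 ∎
      where
      open ≡-Reasoning
      i = fromℕ< p<n

    IsSolution⇒flow≡target : ∀ c → IsSolution (pathLabels c) (sinkLabels c) (sourceLabels c) → flow (suc (suc a)) E c ≡ targetVec a
    IsSolution⇒flow≡target c solution = lookup-extensionality _ _ λ i →
      trans (lookup-flow (suc (suc a)) E c i)
            (trans (outflow-E c (toℕ i)) (trans (solution (toℕ i) (Fin.toℕ<n i)) (sym (lookup-targetVec a i))))

    encode-solution : ∀ f g hs → length f ≡ a → length g ≡ M → length hs ≡ a → IsSolution f g hs →
                      flow (suc (suc a)) E (encode f g hs) ≡ targetVec a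
    encode-solution f g hs length-f length-g length-hs solution = IsSolution⇒flow≡target (encode f g hs) decoded
      where
      decoded : IsSolution (pathLabels (encode f g hs)) (sinkLabels (encode f g hs)) (sourceLabels (encode f g hs))
      decoded p p<n = trans (cong (λ (x , y , z) → outflowOf x y z p) labels≡) (solution p p<n)
        where
        labels≡ : (pathLabels (encode f g hs) , sinkLabels (encode f g hs) , sourceLabels (encode f g hs)) ≡ (f , g , hs)
        labels≡ = cong₂ _,_ (pathLabels-encode f g hs length-f length-g length-hs)
                            (cong₂ _,_ (sinkLabels-encode f g hs length-f length-g length-hs) (sourceLabels-encode f g hs length-f length-g length-hs))

    solutions↔dominatingSeqs : KPFSolutions (suc (suc a)) E (targetVec a) ↔ DominatingSeq M
    solutions↔dominatingSeqs = mk↔ₛ′ to from to∘from from∘to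
      where
      module Nec (c : LabelsOf E) (eq : flow (suc (suc a)) E c ≡ targetVec a) =
        Necessity (pathLabels c) (sinkLabels c) (sourceLabels c) (length-pathLabels c) (length-sinkLabels c) (length-sourceLabels c)
                  (flow≡target⇒IsSolution c eq)
      to : KPFSolutions (suc (suc a)) E (targetVec a) → DominatingSeq M
      to (c , eq) = sourceLabels c , isDominatingSeq (length-sourceLabels c) (Nec.weight≡ c eq) (Nec.dominating c eq)
      encodeForced : List (Vec ℕ k) → LabelsOf E
      encodeForced hs = encode (forcedPath hs) (replicate M 0) hs
      from : DominatingSeq M → KPFSolutions (suc (suc a)) E (targetVec a)
      from (hs , isDominatingSeq length-hs weight≡ dominating) = encodeForced hs ,
        recompute (Vec.≡-dec ℤ._≟_ (flow (suc (suc a)) E (encodeForced hs)) (targetVec a))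
                  (encode-solution (forcedPath hs) (replicate M 0) hs (length-forcedPath hs) (List.length-replicate M) length-hs
                                   (Sufficiency.solution hs length-hs weight≡ dominating))
      to∘from : ∀ s → to (from s) ≡ s
      to∘from (hs , isDominatingSeq length-hs _ _) =
        dominatingSeq-≡ (sourceLabels-encode (forcedPath hs) (replicate M 0) hs (length-forcedPath hs) (List.length-replicate M)
                                             (recompute (length hs ≟ a) length-hs))
      from∘to : ∀ s → from (to s) ≡ s
      from∘to (c , eq) = solution-≡ (trans (cong₂ (λ f g → encode f g (sourceLabels c)) (sym (Nec.path≡forcedPath c eq)) (sym (Nec.sink≡0 c eq)))
                                           (encode-decode c))
        where
        solution-≡ : ∀ {c c′} {eq : flow (suc (suc a)) E c ≡ targetVec a} {eq′ : flow (suc (suc a)) E c′ ≡ targetVec a} → c ≡ c′ →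
                     _≡_ {A = KPFSolutions (suc (suc a)) E (targetVec a)} (c , eq) (c′ , eq′)
        solution-≡ {c} refl = cong (c ,_) (Decidable⇒UIP.≡-irrelevant (Vec.≡-dec ℤ._≟_) _ _)


open import Data.Fin using (Fin)
open import Data.Nat using (ℕ; suc; _+_; _*_; _∸_; _≤_; s≤s; z≤n)
open import Data.Nat.Combinatorics using (_C_)
open import Data.Nat.Properties using (+-∸-assoc; *-comm)
open import Data.Product using (_×_; proj₁; proj₂)
open import Data.Vec using (Vec)
import Data.Vec as Vec
open import Function.Bundles using (_↔_)
open import Function.Properties.Inverse using (↔-refl; ↔-sym; ↔-trans)
import Function.Related.Propositional as Related
open import Relation.Binary.PropositionalEquality using (_≡_; refl; cong; trans)
open import Defs
open FiniteCounting using (Fin-×-cancelˡ)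
open StarsAndBars using (compositions↔)
open Binomial using ([k+1]*c≡nCk⇒[n+1]C[k+1]/[n+1]≡c)
open EdgeLabels using (MCar≡)
open MCarSolutions using (E; solutions↔dominatingSeqs)

KPFSolutions-cong : ∀ {n} {E E′ : Edges} {v} → E ≡ E′ → KPFSolutions n E v ↔ KPFSolutions n E′ v
KPFSolutions-cong refl = ↔-refl

proposition5p5 : (k a : ℕ) → (hk : 1 ≤ k) → (ha : 1 ≤ a) →
    KPFCount (suc (suc a)) (MCar k a) (targetVec a) (Cat a (k * a ∸ 1) (cat-pos (k * a ∸ 1) ha))
proposition5p5 (suc k′) (suc M) (s≤s z≤n) (s≤s z≤n) =
  Fin (Cat a b (cat-pos {a} b (s≤s z≤n)))              ≡⟨ cong Fin ([k+1]*c≡nCk⇒[n+1]C[k+1]/[n+1]≡c (M + b) M c count≡) ⟩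
  Fin c                                                ↔⟨ proj₂ (proj₂ cancelled) ⟩
  DominatingSeq M                                      ↔⟨ solutions↔dominatingSeqs k M ⟨
  KPFSolutions (suc (suc a)) (E k M) (targetVec a)     ↔⟨ KPFSolutions-cong (MCar≡ k a) ⟨
  KPFSolutions (suc (suc a)) (MCar k a) (targetVec a)  ∎
  where
  open Related.EquationalReasoning
  k = suc k′
  a = suc M
  b = k * a ∸ 1
  open CycleLemma {Vec ℕ k} Vec.sum using (DominatingSeq; rotations↔)
  open Flattening k using (seq↔compositions)
  rotations↔Fin : (Fin a × DominatingSeq M) ↔ Fin ((M + a * k ∸ 1) C M)
  rotations↔Fin = ↔-trans (rotations↔ M) (↔-trans (seq↔compositions M) (↔-sym (compositions↔ (a * k) M)))
  cancelled = Fin-×-cancelˡ M _ rotations↔Fin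
  c = proj₁ cancelled
  count≡ : suc M * c ≡ (M + b) C M
  count≡ = trans (proj₁ (proj₂ cancelled)) (cong (_C M) (trans (+-∸-assoc M (s≤s z≤n)) (cong (λ x → M + (x ∸ 1)) (*-comm a k))))
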